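{- Let $k\ge 0$ be an integer and let $x$ be a node of rank at most $k$, and consider a zip tree (not containing $x$, for insertion; containing $x$, for deletion) whose nodes other than $x$ have ranks that are independent random variables, each geometric with mean $1$ (rank $j$ with probability $1/2^{j+1}$), independent of the keys. Then the expected number of nodes on the path that is unzipped during the insertion of $x$, and the expected total number of nodes on the two paths that are zipped during the deletion of $x$, is at most $(3/2)k+1/2$. Moreover, there is a constant $c>1$ such that this number is $O(k)$ with probability at least $1-1/(2c^k)$.
   Context: A zip tree is a binary search tree (distinct keys in symmetric order: left-subtree keys smaller, right-subtree keys larger) in which each node has a numeric rank and the parent of a node has rank strictly greater than that of its left child and greater than or equal to that of its right child. Insertion of a new node $x$: search for $x.\mathit{key}$ from the root until reaching the first node $y$ on the search path with $y.\mathit{rank}\le x.\mathit{rank}$, with strict inequality if $y.\mathit{key}<x.\mathit{key}$ (or a missing node). The unzipped path is the remainder of the search path for $x.\mathit{key}$ starting at $y$; it is split into the path $P$ of its nodes with keys less than $x.\mathit{key}$ and the path $Q$ of its nodes with keys greater than $x.\mathit{key}$ (preserving left subtrees of nodes on $P$ and right subtrees of nodes on $Q$), the top node of $P$ becomes the left child of $x$, the top node of $Q$ becomes the right child of $x$, and $x$ takes the place of $y$. Deletion of a node $x$: let $P$ be the right spine of the left subtree of $x$ and $Q$ the left spine of the right subtree of $x$ (the right spine of a tree is the path from its root following right children; the left spine follows left children). These two paths are zipped: merged top to bottom into a single path in non-increasing rank order from top (ties broken in favor of smaller keys), preserving left subtrees of nodes on $P$ and right subtrees of nodes on $Q$, and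 the top node of the merged path replaces $x$. -}

module Defs where

open import Data.Nat as ℕ using (ℕ; zero; suc; _<ᵇ_; _≡ᵇ_)
open import Data.Bool using (Bool; true; false; if_then_else_; _∧_; _∨_)
open import Data.Integer using (+_)
open import Data.List using (upTo; List; []; _∷_; _++_; map; concatMap; foldr; zip; length)
open import Data.Product using (_×_; _,_; proj₁)
open import Data.Unit using (⊤)
open import Data.Rational using (ℚ; 0ℚ; 1ℚ; ½; _+_; _*_; _/_)
open import Relation.Binary.PropositionalEquality using (_≡_)

-- Trees.  'node l key rank r' : left subtree, key, rank, right subtree.

data Tree : Set where
  leaf : Tree
  node : Tree → ℕ → ℕ → Tree → Tree

inorder : Tree → List (ℕ × ℕ)
inorder leaf = []
inorder (node l k r t) = inorder l ++ ((k , r) ∷ inorder t)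

LeftRankOk : ℕ → Tree → Set
LeftRankOk p leaf = ⊤
LeftRankOk p (node _ _ r _) = r ℕ.< p

RightRankOk : ℕ → Tree → Set
RightRankOk p leaf = ⊤
RightRankOk p (node _ _ r _) = r ℕ.≤ p

-- Heap-order part of the zip tree definition (symmetric order is imposed
-- separately by requiring the in-order traversal to be a strictly
-- increasing list of keys).
ZipHeap : Tree → Set
ZipHeap leaf = ⊤
ZipHeap (node l k r t) = ZipHeap l × ZipHeap t × LeftRankOk r l × RightRankOk r t

insertByKey : ℕ × ℕ → List (ℕ × ℕ) → List (ℕ × ℕ)
insertByKey p [] = p ∷ []
insertByKey (a , ρ) ((k , r) ∷ qs) =
  if a <ᵇ k then (a , ρ) ∷ (k , r) ∷ qs else (k , r) ∷ insertByKey (a , ρ) qs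

searchLen : ℕ → Tree → ℕ
searchLen a leaf = 0
searchLen a (node l k r t) = suc (if a <ᵇ k then searchLen a l else searchLen a t)

-- Insertion of x = (a , ρ): walk the search path until the first node y with
-- y.rank ≤ ρ, strictly if y.key < a; the unzipped path is the rest of the
-- search path starting at y.
unzipLen : ℕ → ℕ → Tree → ℕ
unzipLen a ρ leaf = 0
unzipLen a ρ (node l k r t) =
  if ((k <ᵇ a) ∧ (r <ᵇ ρ)) ∨ ((a <ᵇ k) ∧ ((r <ᵇ ρ) ∨ (r ≡ᵇ ρ)))
  then searchLen a (node l k r t)
  else (if a <ᵇ k then unzipLen a ρ l else unzipLen a ρ t)

rightSpineLen : Tree → ℕ
rightSpineLen leaf = 0
rightSpineLen (node _ _ _ t) = suc (rightSpineLen t)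

leftSpineLen : Tree → ℕ
leftSpineLen leaf = 0
leftSpineLen (node l _ _ _) = suc (leftSpineLen l)

zipLen : ℕ → Tree → ℕ
zipLen a leaf = 0
zipLen a (node l k r t) =
  if a ≡ᵇ k then rightSpineLen l ℕ.+ leftSpineLen t
  else (if a <ᵇ k then zipLen a l else zipLen a t)

boxes : ℕ → ℕ → List (List ℕ)
boxes zero B = [] ∷ []
boxes (suc n) B = concatMap (λ j → map (j ∷_) (boxes n B)) (upTo (suc B))

halfPow : ℕ → ℚ
halfPow zero = 1ℚ
halfPow (suc m) = ½ * halfPow m

prob : List ℕ → ℚ
prob [] = 1ℚ
prob (j ∷ js) = halfPow (suc j) * prob js

ℕtoℚ : ℕ → ℚ
ℕtoℚ n = + n / 1

sumℚ : List ℚ → ℚ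
sumℚ = foldr _+_ 0ℚ

-- Partial sum of the expectation series of f over rank lists with all
-- ranks ≤ B.  E[f] ≤ b  iff  ∀ B → truncExp n B f ≤ b  (nonnegative terms).
truncExp : ℕ → ℕ → (List ℕ → ℕ) → ℚ
truncExp n B f = sumℚ (map (λ rs → prob rs * ℕtoℚ (f rs)) (boxes n B))

truncProb : ℕ → ℕ → (List ℕ → Bool) → ℚ
truncProb n B E = truncExp n B (λ rs → if E rs then 1 else 0)

bound : ℕ → ℚ
bound k = + (3 ℕ.* k ℕ.+ 1) / 2

powℚ : ℚ → ℕ → ℚ
powℚ c zero = 1ℚ
powℚ c (suc m) = c * powℚ c m

-- Random zip trees: a tree-valued function of the rank list of the other
-- nodes which, for each rank list, is the zip tree on the given nodes.

ZipFamilyIns : List ℕ → (List ℕ → Tree) → Set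
ZipFamilyIns ks T = ∀ rs → length rs ≡ length ks →
  ZipHeap (T rs) × inorder (T rs) ≡ zip ks rs

ZipFamilyDel : ℕ → ℕ → List ℕ → (List ℕ → Tree) → Set
ZipFamilyDel a ρ ks T = ∀ rs → length rs ≡ length ks →
  ZipHeap (T rs) × inorder (T rs) ≡ insertByKey (a , ρ) (zip ks rs)

twoℚ : ℚ
twoℚ = + 2 / 1

-- Let a be the key and ρ ≤ k the rank of x.  Read the ranks of the keys below a from a outwards: by the
-- heap order, every node below a on the unzipped path, or on the zipped spines, is a weak record (a
-- left-to-right maximum, ties allowed) of rank < ρ.  Likewise every node above a on these paths is a
-- strict record of rank ≤ ρ among the ranks of the keys above a, read from a outwards.
-- For independent geometric ranks a potential argument on the current maximum shows that the expected
-- number of weak records below ρ is at most ρ, that of strict records up to ρ at most (ρ + 1)/2, and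
-- that (3/2)^(number of weak records below ρ) has expectation at most 2^ρ.  The first two facts give
-- (3ρ + 1)/2 ≤ (3k + 1)/2.  As there are at most ρ + 1 strict records up to ρ, the third one and
-- Markov's inequality give the tail bound with c = 2 and C = 5.

module Submission where

open import Defs
open import Data.Nat using (ℕ; _<ᵇ_) renaming (_≤_ to _≤ℕ_; _<_ to _<ℕ_; _*_ to _*ℕ_; _+_ to _+ℕ_)
open import Data.List using (List; length)
open import Data.List.Membership.Propositional using (_∉_)
open import Data.List.Relation.Unary.Linked using (Linked)
open import Data.Product using (_×_; Σ)
open import Data.Rational using (ℚ; 1ℚ; _≤_; _<_; _*_)

open import Data.Nat using (zero; suc; _≡ᵇ_; _≤?_; _<?_; _⊔_; _∸_; z≤n; s≤s)
import Data.Nat.Properties as ℕ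
open import Data.Integer using () renaming (+_ to ⁺_; _+_ to _+ᶻ_; _*_ to _*ᶻ_)
import Data.Integer.Properties as ℤₚ
open import Data.List
  using ([]; _∷_; _++_; map; concatMap; upTo; applyUpTo; reverse; take; drop; takeWhileᵇ; dropWhileᵇ; zip)
import Data.List.Properties as List
open import Data.List.Relation.Unary.All as All using (All; []; _∷_)
import Data.List.Relation.Unary.All.Properties as All
open import Data.List.Relation.Unary.Any using (here; there)
open import Data.List.Relation.Unary.AllPairs using (AllPairs; []; _∷_)
open import Data.List.Relation.Unary.Linked.Properties using (Linked⇒AllPairs)
open import Data.List.Membership.Propositional using (_∈_)
open import Data.List.Membership.Propositional.Properties using (∈-++⁻)
open import Data.Product using (_,_; proj₁; proj₂)
open import Data.Sum using (inj₁; inj₂)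
open import Data.Bool using (Bool; true; false; not; T; if_then_else_)
open import Data.Unit using (tt)
open import Data.Empty using (⊥-elim)
open import Data.Rational using (0ℚ; ½; _+_; mkℚ; _/_; nonNegative)
import Data.Rational.Properties as ℚ
open import Data.Rational.Properties
  using (≤-refl; ≤-trans; ≤-reflexive; ≤ᵇ⇒≤; module ≤-Reasoning; +-mono-≤; +-monoʳ-≤;
         *-monoˡ-≤-nonNeg; *-monoʳ-≤-nonNeg; +-identityˡ; +-identityʳ; +-assoc;
         *-identityˡ; *-identityʳ; *-zeroʳ; *-assoc; normalize-coprime; /-cong)
open import Data.Rational.Solver using (module +-*-Solver)
open import Data.Nat.Coprimality using (1-coprimeTo) renaming (sym to coprime-sym)
open import Function using (_∘_)
open import Relation.Binary.PropositionalEquality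
open import Relation.Nullary using (Dec; yes; no; ¬_)
open import Relation.Nullary.Decidable using (toWitness)
open import Relation.Nullary.Negation using (contradiction)
open import Algebra.Properties.CommutativeSemigroup ℕ.+-commutativeSemigroup using (xy∙z≈xz∙y)
open +-*-Solver

ℕtoℚ-mkℚ : ∀ n → ℕtoℚ n ≡ mkℚ (⁺ n) 0 (coprime-sym (1-coprimeTo n))
ℕtoℚ-mkℚ n = normalize-coprime (coprime-sym (1-coprimeTo n))

ℕtoℚ-suc : ∀ n → ℕtoℚ (suc n) ≡ 1ℚ + ℕtoℚ n
ℕtoℚ-suc n = trans (/-cong numerator refl) (cong (1ℚ +_) (sym (ℕtoℚ-mkℚ n)))
  where
  numerator : ⁺ suc n ≡ (⁺ 1 *ᶻ ⁺ 1) +ᶻ (⁺ n *ᶻ ⁺ 1)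
  numerator = cong (⁺ 1 +ᶻ_) (sym (ℤₚ.*-identityʳ (⁺ n)))

ℕtoℚ-+ : ∀ m n → ℕtoℚ (m +ℕ n) ≡ ℕtoℚ m + ℕtoℚ n
ℕtoℚ-+ zero n = sym (+-identityˡ (ℕtoℚ n))
ℕtoℚ-+ (suc m) n = begin
  ℕtoℚ (suc (m +ℕ n))       ≡⟨ ℕtoℚ-suc (m +ℕ n) ⟩
  1ℚ + ℕtoℚ (m +ℕ n)        ≡⟨ cong (1ℚ +_) (ℕtoℚ-+ m n) ⟩
  1ℚ + (ℕtoℚ m + ℕtoℚ n)    ≡⟨ sym (+-assoc 1ℚ (ℕtoℚ m) (ℕtoℚ n)) ⟩
  (1ℚ + ℕtoℚ m) + ℕtoℚ n    ≡⟨ cong (_+ ℕtoℚ n) (sym (ℕtoℚ-suc m)) ⟩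
  ℕtoℚ (suc m) + ℕtoℚ n     ∎
  where open ≡-Reasoning

½*ℕtoℚ : ∀ n → ½ * ℕtoℚ n ≡ ⁺ n / 2
½*ℕtoℚ n = trans (cong (½ *_) (ℕtoℚ-mkℚ n)) (/-cong (ℤₚ.*-identityˡ (⁺ n)) refl)

0≤1 : 0ℚ ≤ 1ℚ
0≤1 = ≤ᵇ⇒≤ tt

+-nonNeg : ∀ {p q} → 0ℚ ≤ p → 0ℚ ≤ q → 0ℚ ≤ p + q
+-nonNeg {p} {q} 0≤p 0≤q = subst (_≤ p + q) (+-identityʳ 0ℚ) (+-mono-≤ 0≤p 0≤q)

*-monoˡ-≤-0≤ : ∀ {r p q} → 0ℚ ≤ r → p ≤ q → r * p ≤ r * q
*-monoˡ-≤-0≤ {r} 0≤r = *-monoˡ-≤-nonNeg r {{nonNegative 0≤r}}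

*-monoʳ-≤-0≤ : ∀ {r p q} → 0ℚ ≤ r → p ≤ q → p * r ≤ q * r
*-monoʳ-≤-0≤ {r} 0≤r = *-monoʳ-≤-nonNeg r {{nonNegative 0≤r}}

*-nonNeg : ∀ {p q} → 0ℚ ≤ p → 0ℚ ≤ q → 0ℚ ≤ p * q
*-nonNeg {p} 0≤p 0≤q = subst (_≤ p * _) (*-zeroʳ p) (*-monoˡ-≤-0≤ 0≤p 0≤q)

ℕtoℚ-nonNeg : ∀ n → 0ℚ ≤ ℕtoℚ n
ℕtoℚ-nonNeg zero = ≤-refl
ℕtoℚ-nonNeg (suc n) = subst (0ℚ ≤_) (sym (ℕtoℚ-suc n)) (+-nonNeg 0≤1 (ℕtoℚ-nonNeg n))

ℕtoℚ-mono : ∀ {m n} → m ≤ℕ n → ℕtoℚ m ≤ ℕtoℚ n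
ℕtoℚ-mono {m} {n} m≤n = begin
  ℕtoℚ m                   ≡⟨ sym (+-identityʳ (ℕtoℚ m)) ⟩
  ℕtoℚ m + 0ℚ              ≤⟨ +-monoʳ-≤ (ℕtoℚ m) (ℕtoℚ-nonNeg (n ∸ m)) ⟩
  ℕtoℚ m + ℕtoℚ (n ∸ m)    ≡⟨ sym (ℕtoℚ-+ m (n ∸ m)) ⟩
  ℕtoℚ (m +ℕ (n ∸ m))      ≡⟨ cong ℕtoℚ (ℕ.m+[n∸m]≡n m≤n) ⟩
  ℕtoℚ n                   ∎
  where open ≤-Reasoning

powℚ-+ : ∀ c m n → powℚ c (m +ℕ n) ≡ powℚ c m * powℚ c n
powℚ-+ c zero n = sym (*-identityˡ _)
powℚ-+ c (suc m) n = trans (cong (c *_) (powℚ-+ c m n)) (sym (*-assoc c (powℚ c m) (powℚ c n)))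

powℚ-1ℚ : ∀ n → powℚ 1ℚ n ≡ 1ℚ
powℚ-1ℚ zero = refl
powℚ-1ℚ (suc n) = trans (*-identityˡ _) (powℚ-1ℚ n)

powℚ-distrib-* : ∀ x y n → powℚ x n * powℚ y n ≡ powℚ (x * y) n
powℚ-distrib-* x y zero = *-identityˡ 1ℚ
powℚ-distrib-* x y (suc n) = trans
  (solve 4 (λ x y p q → (x :* p) :* (y :* q) := (x :* y) :* (p :* q)) refl x y (powℚ x n) (powℚ y n))
  (cong ((x * y) *_) (powℚ-distrib-* x y n))

powℚ-* : ∀ c m n → powℚ c (m *ℕ n) ≡ powℚ (powℚ c m) n
powℚ-* c zero n = sym (powℚ-1ℚ n)
powℚ-* c (suc m) n = begin
  powℚ c (n +ℕ m *ℕ n)              ≡⟨ powℚ-+ c n (m *ℕ n) ⟩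
  powℚ c n * powℚ c (m *ℕ n)        ≡⟨ cong (powℚ c n *_) (powℚ-* c m n) ⟩
  powℚ c n * powℚ (powℚ c m) n      ≡⟨ powℚ-distrib-* c (powℚ c m) n ⟩
  powℚ (c * powℚ c m) n             ∎
  where open ≡-Reasoning

powℚ-nonNeg : ∀ {c} → 0ℚ ≤ c → ∀ m → 0ℚ ≤ powℚ c m
powℚ-nonNeg 0≤c zero = 0≤1
powℚ-nonNeg 0≤c (suc m) = *-nonNeg 0≤c (powℚ-nonNeg 0≤c m)

1≤powℚ : ∀ {c} → 1ℚ ≤ c → ∀ m → 1ℚ ≤ powℚ c m
1≤powℚ 1≤c zero = ≤-refl
1≤powℚ {c} 1≤c (suc m) = begin
  1ℚ            ≤⟨ 1≤c ⟩
  c             ≡⟨ sym (*-identityʳ c) ⟩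
  c * 1ℚ        ≤⟨ *-monoˡ-≤-0≤ (≤-trans 0≤1 1≤c) (1≤powℚ 1≤c m) ⟩
  c * powℚ c m  ∎
  where open ≤-Reasoning

powℚ-monoʳ-≤ : ∀ {c m n} → 1ℚ ≤ c → m ≤ℕ n → powℚ c m ≤ powℚ c n
powℚ-monoʳ-≤ {c} {m} {n} 1≤c m≤n = begin
  powℚ c m                        ≡⟨ sym (*-identityʳ (powℚ c m)) ⟩
  powℚ c m * 1ℚ                   ≤⟨ *-monoˡ-≤-0≤ (powℚ-nonNeg (≤-trans 0≤1 1≤c) m) (1≤powℚ 1≤c (n ∸ m)) ⟩
  powℚ c m * powℚ c (n ∸ m)       ≡⟨ sym (powℚ-+ c m (n ∸ m)) ⟩
  powℚ c (m +ℕ (n ∸ m))           ≡⟨ cong (powℚ c) (ℕ.m+[n∸m]≡n m≤n) ⟩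
  powℚ c n                        ∎
  where open ≤-Reasoning

powℚ≤1 : ∀ {c} → 0ℚ ≤ c → c ≤ 1ℚ → ∀ n → powℚ c n ≤ 1ℚ
powℚ≤1 0≤c c≤1 zero = ≤-refl
powℚ≤1 {c} 0≤c c≤1 (suc n) = ≤-trans (*-monoˡ-≤-0≤ 0≤c (powℚ≤1 0≤c c≤1 n)) (≤-trans (≤-reflexive (*-identityʳ c)) c≤1)

halfPow-nonNeg : ∀ m → 0ℚ ≤ halfPow m
halfPow-nonNeg zero = 0≤1
halfPow-nonNeg (suc m) = *-nonNeg {½} (≤ᵇ⇒≤ tt) (halfPow-nonNeg m)

prob-nonNeg : ∀ rs → 0ℚ ≤ prob rs
prob-nonNeg [] = 0≤1
prob-nonNeg (j ∷ rs) = *-nonNeg (halfPow-nonNeg (suc j)) (prob-nonNeg rs)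

sumOver : List ℕ → (ℕ → ℚ) → ℚ
sumOver L v = sumℚ (map v L)

sumOver-cong : ∀ L {v w} → (∀ j → v j ≡ w j) → sumOver L v ≡ sumOver L w
sumOver-cong [] v≡w = refl
sumOver-cong (j ∷ L) v≡w = cong₂ _+_ (v≡w j) (sumOver-cong L v≡w)

sumOver-mono : ∀ L {v w} → (∀ j → v j ≤ w j) → sumOver L v ≤ sumOver L w
sumOver-mono [] v≤w = ≤-refl
sumOver-mono (j ∷ L) v≤w = +-mono-≤ (v≤w j) (sumOver-mono L v≤w)

weightedSum : List (List ℕ) → (List ℕ → ℚ) → ℚ
weightedSum X g = sumℚ (map (λ rs → prob rs * g rs) X)

weightedSum-++ : ∀ X Y g → weightedSum (X ++ Y) g ≡ weightedSum X g + weightedSum Y g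
weightedSum-++ [] Y g = sym (+-identityˡ _)
weightedSum-++ (x ∷ X) Y g = trans (cong (prob x * g x +_) (weightedSum-++ X Y g))
  (sym (+-assoc (prob x * g x) (weightedSum X g) (weightedSum Y g)))

weightedSum-concatMap : ∀ (h : ℕ → List (List ℕ)) L g →
  weightedSum (concatMap h L) g ≡ sumOver L (λ j → weightedSum (h j) g)
weightedSum-concatMap h [] g = refl
weightedSum-concatMap h (j ∷ L) g = trans (weightedSum-++ (h j) (concatMap h L) g)
  (cong (weightedSum (h j) g +_) (weightedSum-concatMap h L g))

weightedSum-map-∷ : ∀ j X g →
  weightedSum (map (j ∷_) X) g ≡ halfPow (suc j) * weightedSum X (λ xs → g (j ∷ xs))
weightedSum-map-∷ j [] g = sym (*-zeroʳ (halfPow (suc j)))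
weightedSum-map-∷ j (x ∷ X) g = trans (cong (prob (j ∷ x) * g (j ∷ x) +_) (weightedSum-map-∷ j X g))
  (solve 4 (λ h p a s → (h :* p) :* a :+ h :* s := h :* (p :* a :+ s))
    refl (halfPow (suc j)) (prob x) (g (j ∷ x)) (weightedSum X (λ xs → g (j ∷ xs))))

weightedSum-cong : ∀ {X g h} → All (λ rs → g rs ≡ h rs) X → weightedSum X g ≡ weightedSum X h
weightedSum-cong [] = refl
weightedSum-cong {x ∷ X} (e ∷ es) = cong₂ _+_ (cong (prob x *_) e) (weightedSum-cong es)

weightedSum-mono : ∀ {X g h} → All (λ rs → g rs ≤ h rs) X → weightedSum X g ≤ weightedSum X h
weightedSum-mono [] = ≤-refl
weightedSum-mono {x ∷ X} (e ∷ es) = +-mono-≤ (*-monoˡ-≤-0≤ (prob-nonNeg x) e) (weightedSum-mono es)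

weightedSum-0 : ∀ X → weightedSum X (λ _ → 0ℚ) ≡ 0ℚ
weightedSum-0 [] = refl
weightedSum-0 (x ∷ X) = trans (cong₂ _+_ (*-zeroʳ (prob x)) (weightedSum-0 X)) (+-identityˡ 0ℚ)

weightedSum-+ : ∀ X g h → weightedSum X (λ rs → g rs + h rs) ≡ weightedSum X g + weightedSum X h
weightedSum-+ [] g h = sym (+-identityˡ 0ℚ)
weightedSum-+ (x ∷ X) g h = trans (cong (prob x * (g x + h x) +_) (weightedSum-+ X g h))
  (solve 5 (λ p a b c d → p :* (a :+ b) :+ (c :+ d) := (p :* a :+ c) :+ (p :* b :+ d))
    refl (prob x) (g x) (h x) (weightedSum X g) (weightedSum X h))

weightedSum-* : ∀ X c g → weightedSum X (λ rs → c * g rs) ≡ c * weightedSum X g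
weightedSum-* [] c g = sym (*-zeroʳ c)
weightedSum-* (x ∷ X) c g = trans (cong (prob x * (c * g x) +_) (weightedSum-* X c g))
  (solve 4 (λ p c a s → p :* (c :* a) :+ c :* s := c :* (p :* a :+ s)) refl (prob x) c (g x) (weightedSum X g))

𝔼 : ℕ → ℕ → (List ℕ → ℚ) → ℚ
𝔼 n B = weightedSum (boxes n B)

𝔼-[] : ∀ B g → 𝔼 0 B g ≡ g []
𝔼-[] B g = trans (+-identityʳ _) (*-identityˡ _)

𝔼-∷ : ∀ n B g → 𝔼 (suc n) B g ≡ sumOver (upTo (suc B)) (λ j → halfPow (suc j) * 𝔼 n B (λ xs → g (j ∷ xs)))
𝔼-∷ n B g = trans (weightedSum-concatMap (λ j → map (j ∷_) (boxes n B)) (upTo (suc B)) g)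
  (sumOver-cong (upTo (suc B)) (λ j → weightedSum-map-∷ j (boxes n B) g))

boxes-length : ∀ n B → All (λ rs → length rs ≡ n) (boxes n B)
boxes-length zero B = refl ∷ []
boxes-length (suc n) B = go (upTo (suc B))
  where
  go : ∀ L → All (λ rs → length rs ≡ suc n) (concatMap (λ j → map (j ∷_) (boxes n B)) L)
  go [] = []
  go (j ∷ L) = All.++⁺ (All.map⁺ (All.map (cong suc) (boxes-length n B))) (go L)

𝔼-cong : ∀ n B {g h} → (∀ rs → length rs ≡ n → g rs ≡ h rs) → 𝔼 n B g ≡ 𝔼 n B h
𝔼-cong n B g≡h = weightedSum-cong (All.map (λ {rs} → g≡h rs) (boxes-length n B))

𝔼-mono : ∀ n B {g h} → (∀ rs → length rs ≡ n → g rs ≤ h rs) → 𝔼 n B g ≤ 𝔼 n B h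
𝔼-mono n B g≤h = weightedSum-mono (All.map (λ {rs} → g≤h rs) (boxes-length n B))

𝔼-nonNeg : ∀ n B {g} → (∀ rs → 0ℚ ≤ g rs) → 0ℚ ≤ 𝔼 n B g
𝔼-nonNeg n B {g} 0≤g = subst (_≤ 𝔼 n B g) (weightedSum-0 (boxes n B)) (𝔼-mono n B (λ rs _ → 0≤g rs))

𝔼-+ : ∀ n B g h → 𝔼 n B (λ xs → g xs + h xs) ≡ 𝔼 n B g + 𝔼 n B h
𝔼-+ n B = weightedSum-+ (boxes n B)

𝔼-* : ∀ n B c g → 𝔼 n B (λ xs → c * g xs) ≡ c * 𝔼 n B g
𝔼-* n B = weightedSum-* (boxes n B)

𝔼-sumOver : ∀ n B L (c : ℕ → ℚ) (h : ℕ → List ℕ → ℚ) →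
  𝔼 n B (λ xs → sumOver L (λ j → c j * h j xs)) ≡ sumOver L (λ j → c j * 𝔼 n B (h j))
𝔼-sumOver n B [] c h = weightedSum-0 (boxes n B)
𝔼-sumOver n B (j ∷ L) c h = trans (𝔼-+ n B (λ xs → c j * h j xs) (λ xs → sumOver L (λ j → c j * h j xs)))
  (cong₂ _+_ (𝔼-* n B (c j) (h j)) (𝔼-sumOver n B L c h))

𝔼-++ : ∀ m p B g → 𝔼 (m +ℕ p) B g ≡ 𝔼 m B (λ xs → 𝔼 p B (λ ys → g (xs ++ ys)))
𝔼-++ zero p B g = sym (𝔼-[] B (λ xs → 𝔼 p B (λ ys → g (xs ++ ys))))
𝔼-++ (suc m) p B g = trans (𝔼-∷ (m +ℕ p) B g)
  (trans (sumOver-cong (upTo (suc B)) (λ j → cong (halfPow (suc j) *_) (𝔼-++ m p B (λ xs → g (j ∷ xs)))))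
         (sym (𝔼-∷ m B (λ xs → 𝔼 p B (λ ys → g (xs ++ ys))))))

-- The potential method

telescope : (V W : ℕ → ℚ) → (∀ t → 0ℚ ≤ W t) → (∀ t → (V t + W (suc t)) * ½ ≤ W t) →
  ∀ m (f : ℕ → ℕ) s → (∀ i → f i ≡ s +ℕ i) →
  sumOver (applyUpTo f m) (λ j → halfPow (suc j) * V j) ≤ halfPow s * W s
telescope V W 0≤W drift zero f s f≗s+ = *-nonNeg (halfPow-nonNeg s) (0≤W s)
telescope V W 0≤W drift (suc m) f s f≗s+ = begin
  halfPow (suc (f 0)) * V (f 0) + rest
    ≡⟨ cong (λ z → halfPow (suc z) * V z + rest) f0≡s ⟩
  halfPow (suc s) * V s + rest
    ≤⟨ +-monoʳ-≤ (halfPow (suc s) * V s)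
         (telescope V W 0≤W drift m (λ i → f (suc i)) (suc s) (λ i → trans (f≗s+ (suc i)) (ℕ.+-suc s i))) ⟩
  halfPow (suc s) * V s + halfPow (suc s) * W (suc s)
    ≡⟨ solve 4 (λ h v w c → (c :* h) :* v :+ (c :* h) :* w := h :* ((v :+ w) :* c))
         refl (halfPow s) (V s) (W (suc s)) ½ ⟩
  halfPow s * ((V s + W (suc s)) * ½)
    ≤⟨ *-monoˡ-≤-0≤ (halfPow-nonNeg s) (drift s) ⟩
  halfPow s * W s ∎
  where
  open ≤-Reasoning
  rest = sumOver (applyUpTo (λ i → f (suc i)) m) (λ j → halfPow (suc j) * V j)
  f0≡s : f 0 ≡ s
  f0≡s = trans (f≗s+ 0) (ℕ.+-identityʳ s)

-- G τ xs is a statistic of the ranks xs scanned with threshold τ: a rank t < τ is skipped, and after a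
-- rank t ≥ τ the rest has expectation at most V t, whatever τ was.  A geometric rank that is ≥ t
-- equals t with probability ½, so the drift condition makes Φ τ a bound on the expectation of G τ.
𝔼≤potential : ∀ B (G : ℕ → List ℕ → ℚ) (Φ V : ℕ → ℚ) →
  (∀ τ → 0ℚ ≤ Φ τ) →
  (∀ τ → G τ [] ≤ Φ τ) →
  (∀ {τ t} xs → t <ℕ τ → G τ (t ∷ xs) ≡ G τ xs) →
  (∀ n {τ t} → τ ≤ℕ t → (∀ τ′ → 𝔼 n B (G τ′) ≤ Φ τ′) → 𝔼 n B (λ xs → G τ (t ∷ xs)) ≤ V t) →
  (∀ t → (V t + Φ (suc t)) * ½ ≤ Φ t) →
  ∀ n τ → 𝔼 n B (G τ) ≤ Φ τ
𝔼≤potential B G Φ V 0≤Φ base skip atRecord drift = go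
  where
  Vτ : ℕ → ℕ → ℚ
  Vτ τ t with τ ≤? t
  ... | yes _ = V t
  ... | no _ = Φ τ

  go : ∀ n τ → 𝔼 n B (G τ) ≤ Φ τ

  step : ∀ n τ t → 𝔼 n B (λ xs → G τ (t ∷ xs)) ≤ Vτ τ t
  step n τ t with τ ≤? t
  ... | yes τ≤t = atRecord n τ≤t (go n)
  ... | no τ≰t = subst (_≤ Φ τ) (𝔼-cong n B (λ xs _ → sym (skip xs (ℕ.≰⇒> τ≰t)))) (go n τ)

  -- With W t = Φ (τ ⊔ t), ranks below τ leave the potential unchanged.
  driftτ : ∀ τ t → (Vτ τ t + Φ (τ ⊔ suc t)) * ½ ≤ Φ (τ ⊔ t)
  driftτ τ t with τ ≤? t
  ... | yes τ≤t rewrite ℕ.m≤n⇒m⊔n≡n τ≤t | ℕ.m≤n⇒m⊔n≡n (ℕ.m≤n⇒m≤1+n τ≤t) = drift t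
  ... | no τ≰t rewrite ℕ.m≥n⇒m⊔n≡m (ℕ.<⇒≤ (ℕ.≰⇒> τ≰t)) | ℕ.m≥n⇒m⊔n≡m (ℕ.≰⇒> τ≰t) =
    ≤-reflexive (solve 1 (λ x → (x :+ x) :* con ½ := x) refl (Φ τ))

  go zero τ = subst (_≤ Φ τ) (sym (𝔼-[] B (G τ))) (base τ)
  go (suc n) τ = begin
    𝔼 (suc n) B (G τ)
      ≡⟨ 𝔼-∷ n B (G τ) ⟩
    sumOver (upTo (suc B)) (λ j → halfPow (suc j) * 𝔼 n B (λ xs → G τ (j ∷ xs)))
      ≤⟨ sumOver-mono (upTo (suc B)) (λ j → *-monoˡ-≤-0≤ (halfPow-nonNeg (suc j)) (step n τ j)) ⟩
    sumOver (upTo (suc B)) (λ j → halfPow (suc j) * Vτ τ j)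
      ≤⟨ telescope (Vτ τ) (λ t → Φ (τ ⊔ t)) (λ t → 0≤Φ (τ ⊔ t)) (driftτ τ) (suc B) (λ i → i) 0 (λ i → refl) ⟩
    1ℚ * Φ (τ ⊔ 0)
      ≡⟨ trans (*-identityˡ _) (cong Φ (ℕ.⊔-identityʳ τ)) ⟩
    Φ τ ∎
    where open ≤-Reasoning

-- The truncated distribution has total mass at most 1, so marginalising only gives inequalities.
𝔼-1≤1 : ∀ n B → 𝔼 n B (λ _ → 1ℚ) ≤ 1ℚ
𝔼-1≤1 n B = 𝔼≤potential B (λ _ _ → 1ℚ) (λ _ → 1ℚ) (λ _ → 1ℚ) (λ _ → 0≤1) (λ _ → ≤-refl)
  (λ _ _ → refl) (λ n _ ih → ih 0) (λ _ → ≤ᵇ⇒≤ tt) n 0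

𝔼-const≤ : ∀ n B {c} → 0ℚ ≤ c → 𝔼 n B (λ _ → c) ≤ c
𝔼-const≤ n B {c} 0≤c = begin
  𝔼 n B (λ _ → c)         ≡⟨ 𝔼-cong n B (λ _ _ → sym (*-identityʳ c)) ⟩
  𝔼 n B (λ _ → c * 1ℚ)    ≡⟨ 𝔼-* n B c (λ _ → 1ℚ) ⟩
  c * 𝔼 n B (λ _ → 1ℚ)    ≤⟨ *-monoˡ-≤-0≤ 0≤c (𝔼-1≤1 n B) ⟩
  c * 1ℚ                  ≡⟨ *-identityʳ c ⟩
  c                       ∎
  where open ≤-Reasoning

𝔼-reverse : ∀ n B g → 𝔼 n B (λ xs → g (reverse xs)) ≡ 𝔼 n B g
𝔼-reverse zero B g = refl
𝔼-reverse (suc n) B g = begin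
  𝔼 (suc n) B (λ xs → g (reverse xs))
    ≡⟨ 𝔼-∷ n B (λ xs → g (reverse xs)) ⟩
  sumOver U (λ j → halfPow (suc j) * 𝔼 n B (λ xs → g (reverse (j ∷ xs))))
    ≡⟨ sumOver-cong U (λ j → cong (halfPow (suc j) *_) (𝔼-cong n B (λ xs _ → cong g (List.unfold-reverse j xs)))) ⟩
  sumOver U (λ j → halfPow (suc j) * 𝔼 n B (λ xs → g (reverse xs ++ j ∷ [])))
    ≡⟨ sumOver-cong U (λ j → cong (halfPow (suc j) *_) (𝔼-reverse n B (λ ys → g (ys ++ j ∷ [])))) ⟩
  sumOver U (λ j → halfPow (suc j) * 𝔼 n B (λ xs → g (xs ++ j ∷ [])))
    ≡⟨ sym (𝔼-sumOver n B U (λ j → halfPow (suc j)) (λ j xs → g (xs ++ j ∷ []))) ⟩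
  𝔼 n B (λ xs → sumOver U (λ j → halfPow (suc j) * g (xs ++ j ∷ [])))
    ≡⟨ 𝔼-cong n B (λ xs _ → sym (𝔼-singleton (λ ys → g (xs ++ ys)))) ⟩
  𝔼 n B (λ xs → 𝔼 1 B (λ ys → g (xs ++ ys)))
    ≡⟨ sym (𝔼-++ n 1 B g) ⟩
  𝔼 (n +ℕ 1) B g
    ≡⟨ cong (λ m → 𝔼 m B g) (ℕ.+-comm n 1) ⟩
  𝔼 (suc n) B g ∎
  where
  open ≡-Reasoning
  U = upTo (suc B)
  𝔼-singleton : ∀ h → 𝔼 1 B h ≡ sumOver U (λ j → halfPow (suc j) * h (j ∷ []))
  𝔼-singleton h = trans (𝔼-∷ 0 B h) (sumOver-cong U (λ j → cong (halfPow (suc j) *_) (𝔼-[] B (λ xs → h (j ∷ xs)))))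

take-++ : ∀ (xs ys : List ℕ) → take (length xs) (xs ++ ys) ≡ xs
take-++ [] ys = refl
take-++ (x ∷ xs) ys = cong (x ∷_) (take-++ xs ys)

drop-++ : ∀ (xs ys : List ℕ) → drop (length xs) (xs ++ ys) ≡ ys
drop-++ [] ys = refl
drop-++ (x ∷ xs) ys = drop-++ xs ys

𝔼-take≤ : ∀ B {m n} (h : List ℕ → ℚ) → (∀ xs → 0ℚ ≤ h xs) → m ≤ℕ n →
  𝔼 n B (λ rs → h (take m rs)) ≤ 𝔼 m B h
𝔼-take≤ B {m} {n} h 0≤h m≤n = subst (λ n → 𝔼 n B (λ rs → h (take m rs)) ≤ 𝔼 m B h) (ℕ.m+[n∸m]≡n m≤n) (begin
  𝔼 (m +ℕ p) B (λ rs → h (take m rs))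
    ≡⟨ 𝔼-++ m p B (λ rs → h (take m rs)) ⟩
  𝔼 m B (λ xs → 𝔼 p B (λ ys → h (take m (xs ++ ys))))
    ≡⟨ 𝔼-cong m B (λ xs ∣xs∣≡m → 𝔼-cong p B (λ ys _ → cong h
         (trans (cong (λ i → take i (xs ++ ys)) (sym ∣xs∣≡m)) (take-++ xs ys)))) ⟩
  𝔼 m B (λ xs → 𝔼 p B (λ _ → h xs))
    ≤⟨ 𝔼-mono m B (λ xs _ → 𝔼-const≤ p B (0≤h xs)) ⟩
  𝔼 m B h ∎)
  where
  open ≤-Reasoning
  p = n ∸ m

𝔼-drop≤ : ∀ B {m n} (h : List ℕ → ℚ) → (∀ xs → 0ℚ ≤ h xs) → m ≤ℕ n →
  𝔼 n B (λ rs → h (drop m rs)) ≤ 𝔼 (n ∸ m) B h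
𝔼-drop≤ B {m} {n} h 0≤h m≤n = subst (λ n → 𝔼 n B (λ rs → h (drop m rs)) ≤ 𝔼 p B h) (ℕ.m+[n∸m]≡n m≤n) (begin
  𝔼 (m +ℕ p) B (λ rs → h (drop m rs))
    ≡⟨ 𝔼-++ m p B (λ rs → h (drop m rs)) ⟩
  𝔼 m B (λ xs → 𝔼 p B (λ ys → h (drop m (xs ++ ys))))
    ≡⟨ 𝔼-cong m B (λ xs ∣xs∣≡m → 𝔼-cong p B (λ ys _ → cong h
         (trans (cong (λ i → drop i (xs ++ ys)) (sym ∣xs∣≡m)) (drop-++ xs ys)))) ⟩
  𝔼 m B (λ _ → 𝔼 p B h)
    ≤⟨ 𝔼-const≤ m B (𝔼-nonNeg p B 0≤h) ⟩
  𝔼 p B h ∎)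
  where
  open ≤-Reasoning
  p = n ∸ m

-- Records of a rank sequence

𝟙 : {P : Set} → Dec P → ℕ
𝟙 (yes _) = 1
𝟙 (no _) = 0

𝟙-yes : ∀ {P : Set} (P? : Dec P) → P → 𝟙 P? ≡ 1
𝟙-yes (yes _) _ = refl
𝟙-yes (no ¬p) p = contradiction p ¬p

-- Scanning with threshold τ, a rank x ≥ τ is a record: it is counted if x < β, and the threshold
-- becomes next x.  Thus next = id gives weak records (ties allowed) and next = suc strict ones.
recordsBelow : (ℕ → ℕ) → ℕ → ℕ → List ℕ → ℕ
recordsBelow next β τ [] = 0
recordsBelow next β τ (x ∷ xs) with τ ≤? x
... | yes _ = 𝟙 (x <? β) +ℕ recordsBelow next β (next x) xs
... | no _ = recordsBelow next β τ xs

weakRecordsBelow strictRecordsBelow : ℕ → ℕ → List ℕ → ℕ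
weakRecordsBelow = recordsBelow (λ x → x)
strictRecordsBelow = recordsBelow suc

recordsBelow-record : ∀ next β {τ x} xs → τ ≤ℕ x →
  recordsBelow next β τ (x ∷ xs) ≡ 𝟙 (x <? β) +ℕ recordsBelow next β (next x) xs
recordsBelow-record next β {τ} {x} xs τ≤x with τ ≤? x
... | yes _ = refl
... | no τ≰x = contradiction τ≤x τ≰x

recordsBelow-skip : ∀ next β {τ x} xs → x <ℕ τ → recordsBelow next β τ (x ∷ xs) ≡ recordsBelow next β τ xs
recordsBelow-skip next β {τ} {x} xs x<τ with τ ≤? x
... | yes τ≤x = contradiction τ≤x (ℕ.<⇒≱ x<τ)
... | no _ = refl

recordsBelow-++-record : ∀ next β {τ r} zs ws → All (λ z → next z ≤ℕ r) zs → τ ≤ℕ r →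
  recordsBelow next β τ zs +ℕ 𝟙 (r <? β) ≤ℕ recordsBelow next β τ (zs ++ r ∷ ws)
recordsBelow-++-record next β {τ} {r} [] ws [] τ≤r
  rewrite recordsBelow-record next β ws τ≤r = ℕ.m≤m+n (𝟙 (r <? β)) _
recordsBelow-++-record next β {τ} {r} (z ∷ zs) ws (nz≤r ∷ nzs≤r) τ≤r with τ ≤? z
... | yes _ = ℕ.≤-trans (ℕ.≤-reflexive (ℕ.+-assoc (𝟙 (z <? β)) _ (𝟙 (r <? β))))
                (ℕ.+-monoʳ-≤ (𝟙 (z <? β)) (recordsBelow-++-record next β zs ws nzs≤r nz≤r))
... | no _ = recordsBelow-++-record next β zs ws nzs≤r τ≤r

∸-suc : ∀ {m n} → n <ℕ m → m ∸ n ≡ suc (m ∸ suc n)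
∸-suc {suc m} {zero} _ = refl
∸-suc {suc m} {suc n} (s≤s n<m) = ∸-suc n<m

strictRecordsBelow≤ : ∀ β τ xs → strictRecordsBelow β τ xs ≤ℕ β ∸ τ
strictRecordsBelow≤ β τ [] = z≤n
strictRecordsBelow≤ β τ (x ∷ xs) with τ ≤? x
... | no _ = strictRecordsBelow≤ β τ xs
... | yes τ≤x with x <? β
...   | yes x<β = ℕ.≤-trans (s≤s (strictRecordsBelow≤ β (suc x) xs))
                    (ℕ.≤-trans (ℕ.≤-reflexive (sym (∸-suc x<β))) (ℕ.∸-monoʳ-≤ β τ≤x))
...   | no x≮β = ℕ.≤-trans (strictRecordsBelow≤ β (suc x) xs)
                   (ℕ.≤-trans (ℕ.≤-reflexive (ℕ.m≤n⇒m∸n≡0 (ℕ.m≤n⇒m≤1+n (ℕ.≮⇒≥ x≮β)))) z≤n)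

𝔼-recordsBelow : ∀ B next β (Φ : ℕ → ℚ) → (∀ τ → 0ℚ ≤ Φ τ) →
  (∀ t → (ℕtoℚ (𝟙 (t <? β)) + Φ (next t) + Φ (suc t)) * ½ ≤ Φ t) →
  ∀ n τ → 𝔼 n B (λ xs → ℕtoℚ (recordsBelow next β τ xs)) ≤ Φ τ
𝔼-recordsBelow B next β Φ 0≤Φ drift =
  𝔼≤potential B (λ τ xs → ℕtoℚ (recordsBelow next β τ xs)) Φ (λ t → ℕtoℚ (𝟙 (t <? β)) + Φ (next t))
    0≤Φ 0≤Φ (λ xs x<τ → cong ℕtoℚ (recordsBelow-skip next β xs x<τ)) atRecord drift
  where
  atRecord : ∀ n {τ t} → τ ≤ℕ t → (∀ τ′ → 𝔼 n B (λ xs → ℕtoℚ (recordsBelow next β τ′ xs)) ≤ Φ τ′) →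
    𝔼 n B (λ xs → ℕtoℚ (recordsBelow next β τ (t ∷ xs))) ≤ ℕtoℚ (𝟙 (t <? β)) + Φ (next t)
  atRecord n {τ} {t} τ≤t ih = begin
    𝔼 n B (λ xs → ℕtoℚ (recordsBelow next β τ (t ∷ xs)))
      ≡⟨ 𝔼-cong n B (λ xs _ → trans (cong ℕtoℚ (recordsBelow-record next β xs τ≤t)) (ℕtoℚ-+ c _)) ⟩
    𝔼 n B (λ xs → ℕtoℚ c + ℕtoℚ (recordsBelow next β (next t) xs))
      ≡⟨ 𝔼-+ n B (λ _ → ℕtoℚ c) (λ xs → ℕtoℚ (recordsBelow next β (next t) xs)) ⟩
    𝔼 n B (λ _ → ℕtoℚ c) + 𝔼 n B (λ xs → ℕtoℚ (recordsBelow next β (next t) xs))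
      ≤⟨ +-mono-≤ (𝔼-const≤ n B (ℕtoℚ-nonNeg c)) (ih (next t)) ⟩
    ℕtoℚ c + Φ (next t) ∎
    where
    open ≤-Reasoning
    c = 𝟙 (t <? β)

𝔼-weakRecordsBelow : ∀ B ρ n τ → 𝔼 n B (λ xs → ℕtoℚ (weakRecordsBelow ρ τ xs)) ≤ ℕtoℚ (ρ ∸ τ)
𝔼-weakRecordsBelow B ρ = 𝔼-recordsBelow B (λ x → x) ρ (λ τ → ℕtoℚ (ρ ∸ τ)) (λ τ → ℕtoℚ-nonNeg (ρ ∸ τ)) drift
  where
  drift : ∀ t → (ℕtoℚ (𝟙 (t <? ρ)) + ℕtoℚ (ρ ∸ t) + ℕtoℚ (ρ ∸ suc t)) * ½ ≤ ℕtoℚ (ρ ∸ t)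
  drift t with t <? ρ
  ... | yes t<ρ rewrite ∸-suc t<ρ | ℕtoℚ-suc (ρ ∸ suc t) =
    ≤-reflexive (solve 1 (λ x → (con 1ℚ :+ (con 1ℚ :+ x) :+ x) :* con ½ := con 1ℚ :+ x) refl (ℕtoℚ (ρ ∸ suc t)))
  ... | no t≮ρ rewrite ℕ.m≤n⇒m∸n≡0 (ℕ.≮⇒≥ t≮ρ) | ℕ.m≤n⇒m∸n≡0 (ℕ.m≤n⇒m≤1+n (ℕ.≮⇒≥ t≮ρ)) = ≤ᵇ⇒≤ tt

𝔼-strictRecordsBelow : ∀ B β n τ → 𝔼 n B (λ xs → ℕtoℚ (strictRecordsBelow β τ xs)) ≤ ½ * ℕtoℚ (β ∸ τ)
𝔼-strictRecordsBelow B β =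
  𝔼-recordsBelow B suc β (λ τ → ½ * ℕtoℚ (β ∸ τ)) (λ τ → *-nonNeg {½} (≤ᵇ⇒≤ tt) (ℕtoℚ-nonNeg (β ∸ τ))) drift
  where
  drift : ∀ t → (ℕtoℚ (𝟙 (t <? β)) + ½ * ℕtoℚ (β ∸ suc t) + ½ * ℕtoℚ (β ∸ suc t)) * ½ ≤ ½ * ℕtoℚ (β ∸ t)
  drift t with t <? β
  ... | yes t<β rewrite ∸-suc t<β | ℕtoℚ-suc (β ∸ suc t) =
    ≤-reflexive (solve 1 (λ x → (con 1ℚ :+ con ½ :* x :+ con ½ :* x) :* con ½ := con ½ :* (con 1ℚ :+ x))
      refl (ℕtoℚ (β ∸ suc t)))
  ... | no t≮β rewrite ℕ.m≤n⇒m∸n≡0 (ℕ.≮⇒≥ t≮β) | ℕ.m≤n⇒m∸n≡0 (ℕ.m≤n⇒m≤1+n (ℕ.≮⇒≥ t≮β)) = ≤ᵇ⇒≤ tt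

threeHalves : ℚ
threeHalves = ⁺ 3 / 2

𝔼-threeHalves^weakRecordsBelow : ∀ B ρ n τ →
  𝔼 n B (λ xs → powℚ threeHalves (weakRecordsBelow ρ τ xs)) ≤ powℚ twoℚ (ρ ∸ τ)
𝔼-threeHalves^weakRecordsBelow B ρ =
  𝔼≤potential B G (λ τ → powℚ twoℚ (ρ ∸ τ)) (λ t → powℚ threeHalves (𝟙 (t <? ρ)) * powℚ twoℚ (ρ ∸ t))
    (λ τ → powℚ-nonNeg (≤ᵇ⇒≤ tt) (ρ ∸ τ)) (λ τ → 1≤powℚ (≤ᵇ⇒≤ tt) (ρ ∸ τ))
    (λ xs x<τ → cong (powℚ threeHalves) (recordsBelow-skip (λ x → x) ρ xs x<τ)) atRecord drift
  where
  G : ℕ → List ℕ → ℚ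
  G τ xs = powℚ threeHalves (weakRecordsBelow ρ τ xs)
  atRecord : ∀ n {τ t} → τ ≤ℕ t → (∀ τ′ → 𝔼 n B (G τ′) ≤ powℚ twoℚ (ρ ∸ τ′)) →
    𝔼 n B (λ xs → G τ (t ∷ xs)) ≤ powℚ threeHalves (𝟙 (t <? ρ)) * powℚ twoℚ (ρ ∸ t)
  atRecord n {τ} {t} τ≤t ih = begin
    𝔼 n B (λ xs → G τ (t ∷ xs))
      ≡⟨ 𝔼-cong n B (λ xs _ → trans (cong (powℚ threeHalves) (recordsBelow-record (λ x → x) ρ xs τ≤t))
                                     (powℚ-+ threeHalves (𝟙 (t <? ρ)) _)) ⟩
    𝔼 n B (λ xs → powℚ threeHalves (𝟙 (t <? ρ)) * G t xs)
      ≡⟨ 𝔼-* n B (powℚ threeHalves (𝟙 (t <? ρ))) (G t) ⟩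
    powℚ threeHalves (𝟙 (t <? ρ)) * 𝔼 n B (G t)
      ≤⟨ *-monoˡ-≤-0≤ (powℚ-nonNeg (≤ᵇ⇒≤ tt) (𝟙 (t <? ρ))) (ih t) ⟩
    powℚ threeHalves (𝟙 (t <? ρ)) * powℚ twoℚ (ρ ∸ t) ∎
    where open ≤-Reasoning
  drift : ∀ t → (powℚ threeHalves (𝟙 (t <? ρ)) * powℚ twoℚ (ρ ∸ t) + powℚ twoℚ (ρ ∸ suc t)) * ½ ≤ powℚ twoℚ (ρ ∸ t)
  drift t with t <? ρ
  ... | yes t<ρ rewrite ∸-suc t<ρ =
    ≤-reflexive (solve 1 (λ x → (con threeHalves :* con 1ℚ :* (con twoℚ :* x) :+ x) :* con ½ := con twoℚ :* x)
      refl (powℚ twoℚ (ρ ∸ suc t)))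
  ... | no t≮ρ rewrite ℕ.m≤n⇒m∸n≡0 (ℕ.≮⇒≥ t≮ρ) | ℕ.m≤n⇒m∸n≡0 (ℕ.m≤n⇒m≤1+n (ℕ.≮⇒≥ t≮ρ)) = ≤ᵇ⇒≤ tt

rankBound : ℕ → ℕ → List ℕ → ℕ
rankBound ρ m rs = weakRecordsBelow ρ 0 (reverse (take m rs)) +ℕ strictRecordsBelow (suc ρ) 0 (drop m rs)

𝔼-rankBound : ∀ B ρ {m n} → m ≤ℕ n → 𝔼 n B (λ rs → ℕtoℚ (rankBound ρ m rs)) ≤ ℕtoℚ ρ + ½ * ℕtoℚ (suc ρ)
𝔼-rankBound B ρ {m} {n} m≤n = begin
  𝔼 n B (λ rs → ℕtoℚ (rankBound ρ m rs))
    ≡⟨ 𝔼-cong n B (λ rs _ → ℕtoℚ-+ (Lw (reverse (take m rs))) (Rs (drop m rs))) ⟩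
  𝔼 n B (λ rs → ℕtoℚ (Lw (reverse (take m rs))) + ℕtoℚ (Rs (drop m rs)))
    ≡⟨ 𝔼-+ n B (λ rs → ℕtoℚ (Lw (reverse (take m rs)))) (λ rs → ℕtoℚ (Rs (drop m rs))) ⟩
  𝔼 n B (λ rs → ℕtoℚ (Lw (reverse (take m rs)))) + 𝔼 n B (λ rs → ℕtoℚ (Rs (drop m rs)))
    ≤⟨ +-mono-≤ (𝔼-take≤ B (λ xs → ℕtoℚ (Lw (reverse xs))) (λ xs → ℕtoℚ-nonNeg (Lw (reverse xs))) m≤n)
                (𝔼-drop≤ B (λ ys → ℕtoℚ (Rs ys)) (λ ys → ℕtoℚ-nonNeg (Rs ys)) m≤n) ⟩
  𝔼 m B (λ xs → ℕtoℚ (Lw (reverse xs))) + 𝔼 (n ∸ m) B (λ ys → ℕtoℚ (Rs ys))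
    ≡⟨ cong (_+ 𝔼 (n ∸ m) B (λ ys → ℕtoℚ (Rs ys))) (𝔼-reverse m B (λ xs → ℕtoℚ (Lw xs))) ⟩
  𝔼 m B (λ xs → ℕtoℚ (Lw xs)) + 𝔼 (n ∸ m) B (λ ys → ℕtoℚ (Rs ys))
    ≤⟨ +-mono-≤ (𝔼-weakRecordsBelow B ρ m 0) (𝔼-strictRecordsBelow B (suc ρ) (n ∸ m) 0) ⟩
  ℕtoℚ ρ + ½ * ℕtoℚ (suc ρ) ∎
  where
  open ≤-Reasoning
  Lw Rs : List ℕ → ℕ
  Lw = weakRecordsBelow ρ 0
  Rs = strictRecordsBelow (suc ρ) 0

ρ+½[ρ+1]≤bound : ∀ {ρ k} → ρ ≤ℕ k → ℕtoℚ ρ + ½ * ℕtoℚ (suc ρ) ≤ bound k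
ρ+½[ρ+1]≤bound {ρ} {k} ρ≤k = begin
  ℕtoℚ ρ + ½ * ℕtoℚ (suc ρ)
    ≡⟨ cong (λ z → ℕtoℚ ρ + ½ * z) (ℕtoℚ-suc ρ) ⟩
  ℕtoℚ ρ + ½ * (1ℚ + ℕtoℚ ρ)
    ≡⟨ solve 1 (λ x → x :+ con ½ :* (con 1ℚ :+ x) := con ½ :* ((x :+ (x :+ (x :+ con 0ℚ))) :+ con 1ℚ)) refl (ℕtoℚ ρ) ⟩
  ½ * ((ℕtoℚ ρ + (ℕtoℚ ρ + (ℕtoℚ ρ + 0ℚ))) + 1ℚ)
    ≡⟨ cong (½ *_) (sym (ℕtoℚ-3ρ+1 ρ)) ⟩
  ½ * ℕtoℚ (3 *ℕ ρ +ℕ 1)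
    ≤⟨ *-monoˡ-≤-0≤ {½} (≤ᵇ⇒≤ tt) (ℕtoℚ-mono (ℕ.+-monoˡ-≤ 1 (ℕ.*-monoʳ-≤ 3 ρ≤k))) ⟩
  ½ * ℕtoℚ (3 *ℕ k +ℕ 1)
    ≡⟨ ½*ℕtoℚ (3 *ℕ k +ℕ 1) ⟩
  bound k ∎
  where
  open ≤-Reasoning
  ℕtoℚ-3ρ+1 : ∀ x → ℕtoℚ (3 *ℕ x +ℕ 1) ≡ (ℕtoℚ x + (ℕtoℚ x + (ℕtoℚ x + 0ℚ))) + 1ℚ
  ℕtoℚ-3ρ+1 x = trans (ℕtoℚ-+ (3 *ℕ x) 1) (cong (_+ 1ℚ)
    (trans (ℕtoℚ-+ x _) (cong (ℕtoℚ x +_) (trans (ℕtoℚ-+ x _) (cong (ℕtoℚ x +_) (ℕtoℚ-+ x 0))))))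

𝔼≤bound : ∀ B {k ρ m n} (X : List ℕ → ℕ) → ρ ≤ℕ k → m ≤ℕ n →
  (∀ rs → length rs ≡ n → X rs ≤ℕ rankBound ρ m rs) → truncExp n B X ≤ bound k
𝔼≤bound B {ρ = ρ} {n = n} X ρ≤k m≤n X≤ =
  ≤-trans (𝔼-mono n B (λ rs ∣rs∣ → ℕtoℚ-mono (X≤ rs ∣rs∣)))
    (≤-trans (𝔼-rankBound B ρ m≤n) (ρ+½[ρ+1]≤bound ρ≤k))

twoThirds : ℚ
twoThirds = ⁺ 2 / 3

markovWeight : ℕ → ℚ
markovWeight k = powℚ twoThirds (4 *ℕ (k +ℕ 1))

markovWeight-nonNeg : ∀ k → 0ℚ ≤ markovWeight k
markovWeight-nonNeg k = powℚ-nonNeg {twoThirds} (≤ᵇ⇒≤ tt) (4 *ℕ (k +ℕ 1))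

1≤twoThirds^N*threeHalves^L : ∀ {N L} → N ≤ℕ L → 1ℚ ≤ powℚ twoThirds N * powℚ threeHalves L
1≤twoThirds^N*threeHalves^L {N} {L} N≤L = begin
  1ℚ
    ≤⟨ 1≤powℚ (≤ᵇ⇒≤ tt) (L ∸ N) ⟩
  powℚ threeHalves (L ∸ N)
    ≡⟨ sym (*-identityˡ _) ⟩
  1ℚ * powℚ threeHalves (L ∸ N)
    ≡⟨ cong (_* powℚ threeHalves (L ∸ N)) (trans (sym (powℚ-1ℚ N)) (sym (powℚ-distrib-* twoThirds threeHalves N))) ⟩
  (powℚ twoThirds N * powℚ threeHalves N) * powℚ threeHalves (L ∸ N)
    ≡⟨ *-assoc (powℚ twoThirds N) _ _ ⟩
  powℚ twoThirds N * (powℚ threeHalves N * powℚ threeHalves (L ∸ N))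
    ≡⟨ cong (powℚ twoThirds N *_) (sym (powℚ-+ threeHalves N (L ∸ N))) ⟩
  powℚ twoThirds N * powℚ threeHalves (N +ℕ (L ∸ N))
    ≡⟨ cong (λ i → powℚ twoThirds N * powℚ threeHalves i) (ℕ.m+[n∸m]≡n N≤L) ⟩
  powℚ twoThirds N * powℚ threeHalves L ∎
  where open ≤-Reasoning

-- Pointwise Markov bound for the moment (3/2)^L: as R ≤ k + 1, exceeding 5 (k + 1) forces L ≥ 4 (k + 1).
tail-indicator≤ : ∀ {k ρ U L R} → ρ ≤ℕ k → U ≤ℕ L +ℕ R → R ≤ℕ suc ρ →
  ℕtoℚ (if 5 *ℕ (k +ℕ 1) <ᵇ U then 1 else 0) ≤ markovWeight k * powℚ threeHalves L
tail-indicator≤ {k} {ρ} {U} {L} {R} ρ≤k U≤L+R R≤1+ρ with 5 *ℕ (k +ℕ 1) <ᵇ U in exceeds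
... | false = *-nonNeg (markovWeight-nonNeg k) (powℚ-nonNeg {threeHalves} (≤ᵇ⇒≤ tt) L)
... | true = 1≤twoThirds^N*threeHalves^L (ℕ.<⇒≤ (ℕ.+-cancelˡ-< (k +ℕ 1) _ L (ℕ.<-≤-trans 5[k+1]<U U≤k+1+L)))
  where
  5[k+1]<U : 5 *ℕ (k +ℕ 1) <ℕ U
  5[k+1]<U = ℕ.<ᵇ⇒< _ U (subst T (sym exceeds) tt)
  U≤k+1+L : U ≤ℕ (k +ℕ 1) +ℕ L
  U≤k+1+L = begin
    U              ≤⟨ U≤L+R ⟩
    L +ℕ R         ≤⟨ ℕ.+-monoʳ-≤ L (ℕ.≤-trans R≤1+ρ (s≤s ρ≤k)) ⟩
    L +ℕ suc k     ≡⟨ ℕ.+-comm L (suc k) ⟩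
    suc k +ℕ L     ≡⟨ cong (_+ℕ L) (ℕ.+-comm 1 k) ⟩
    k +ℕ 1 +ℕ L    ∎
    where open ℕ.≤-Reasoning

markovWeight*2^ρ*2^[k+1]≤1 : ∀ {k ρ} → ρ ≤ℕ k → (markovWeight k * powℚ twoℚ ρ) * (twoℚ * powℚ twoℚ k) ≤ 1ℚ
markovWeight*2^ρ*2^[k+1]≤1 {k} {ρ} ρ≤k = begin
  (markovWeight k * powℚ twoℚ ρ) * (twoℚ * A)
    ≤⟨ *-monoʳ-≤-0≤ (*-nonNeg {twoℚ} (≤ᵇ⇒≤ tt) (powℚ-nonNeg {twoℚ} (≤ᵇ⇒≤ tt) k))
         (*-monoˡ-≤-0≤ (markovWeight-nonNeg k) (powℚ-monoʳ-≤ {twoℚ} (≤ᵇ⇒≤ tt) ρ≤k)) ⟩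
  (markovWeight k * A) * (twoℚ * A)
    ≡⟨ cong (λ z → (z * A) * (twoℚ * A)) (trans (powℚ-* twoThirds 4 (k +ℕ 1)) (cong (powℚ q) (ℕ.+-comm k 1))) ⟩
  (powℚ q (suc k) * A) * (twoℚ * A)
    ≡⟨ solve 4 (λ q P A t → ((q :* P) :* A) :* (t :* A) := (q :* t) :* ((P :* A) :* A)) refl q (powℚ q k) A twoℚ ⟩
  (q * twoℚ) * ((powℚ q k * A) * A)
    ≡⟨ cong ((q * twoℚ) *_) (trans (cong (_* A) (powℚ-distrib-* q twoℚ k)) (powℚ-distrib-* (q * twoℚ) twoℚ k)) ⟩
  (q * twoℚ) * powℚ ((q * twoℚ) * twoℚ) k
    ≤⟨ *-monoˡ-≤-0≤ (≤ᵇ⇒≤ tt) (powℚ≤1 (≤ᵇ⇒≤ tt) (≤ᵇ⇒≤ tt) k) ⟩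
  (q * twoℚ) * 1ℚ
    ≤⟨ ≤ᵇ⇒≤ tt ⟩
  1ℚ ∎
  where
  open ≤-Reasoning
  q = powℚ twoThirds 4
  A = powℚ twoℚ k

truncProb≤markovWeight*2^ρ : ∀ B {k ρ m n} (X : List ℕ → ℕ) → ρ ≤ℕ k → m ≤ℕ n →
  (∀ rs → length rs ≡ n → X rs ≤ℕ rankBound ρ m rs) →
  truncProb n B (λ rs → 5 *ℕ (k +ℕ 1) <ᵇ X rs) ≤ markovWeight k * powℚ twoℚ ρ
truncProb≤markovWeight*2^ρ B {k} {ρ} {m} {n} X ρ≤k m≤n X≤ = begin
  truncProb n B (λ rs → 5 *ℕ (k +ℕ 1) <ᵇ X rs)
    ≤⟨ 𝔼-mono n B (λ rs ∣rs∣ → tail-indicator≤ ρ≤k (X≤ rs ∣rs∣) (strictRecordsBelow≤ (suc ρ) 0 (drop m rs))) ⟩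
  𝔼 n B (λ rs → markovWeight k * M (reverse (take m rs)))
    ≡⟨ 𝔼-* n B (markovWeight k) (λ rs → M (reverse (take m rs))) ⟩
  markovWeight k * 𝔼 n B (λ rs → M (reverse (take m rs)))
    ≤⟨ *-monoˡ-≤-0≤ (markovWeight-nonNeg k) (𝔼-take≤ B (λ xs → M (reverse xs)) (λ xs → 0≤M (reverse xs)) m≤n) ⟩
  markovWeight k * 𝔼 m B (λ xs → M (reverse xs))
    ≡⟨ cong (markovWeight k *_) (𝔼-reverse m B M) ⟩
  markovWeight k * 𝔼 m B M
    ≤⟨ *-monoˡ-≤-0≤ (markovWeight-nonNeg k) (𝔼-threeHalves^weakRecordsBelow B ρ m 0) ⟩
  markovWeight k * powℚ twoℚ ρ ∎
  where
  open ≤-Reasoning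
  M : List ℕ → ℚ
  M xs = powℚ threeHalves (weakRecordsBelow ρ 0 xs)
  0≤M : ∀ xs → 0ℚ ≤ M xs
  0≤M xs = powℚ-nonNeg {threeHalves} (≤ᵇ⇒≤ tt) (weakRecordsBelow ρ 0 xs)

tail≤ : ∀ B {k ρ m n} (X : List ℕ → ℕ) → ρ ≤ℕ k → m ≤ℕ n →
  (∀ rs → length rs ≡ n → X rs ≤ℕ rankBound ρ m rs) →
  truncProb n B (λ rs → 5 *ℕ (k +ℕ 1) <ᵇ X rs) * (twoℚ * powℚ twoℚ k) ≤ 1ℚ
tail≤ B {k} X ρ≤k m≤n X≤ = ≤-trans
  (*-monoʳ-≤-0≤ (*-nonNeg {twoℚ} (≤ᵇ⇒≤ tt) (powℚ-nonNeg {twoℚ} (≤ᵇ⇒≤ tt) k))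
    (truncProb≤markovWeight*2^ρ B X ρ≤k m≤n X≤))
  (markovWeight*2^ρ*2^[k+1]≤1 ρ≤k)

-- Search paths in zip trees

ranks : List (ℕ × ℕ) → List ℕ
ranks = map proj₂

AllKeys : (ℕ → Bool) → List (ℕ × ℕ) → Set
AllKeys p = All (λ e → p (proj₁ e) ≡ true)

takeKeysWhile dropKeysWhile : (ℕ → Bool) → List (ℕ × ℕ) → List (ℕ × ℕ)
takeKeysWhile p = takeWhileᵇ (p ∘ proj₁)
dropKeysWhile p = dropWhileᵇ (p ∘ proj₁)

module _ (p : ℕ → Bool) where

  takeKeysWhile-++-stop : ∀ xs y ys → p (proj₁ y) ≡ false → takeKeysWhile p (xs ++ y ∷ ys) ≡ takeKeysWhile p xs
  takeKeysWhile-++-stop [] y ys py rewrite py = refl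
  takeKeysWhile-++-stop (x ∷ xs) y ys py with p (proj₁ x)
  ... | true = cong (x ∷_) (takeKeysWhile-++-stop xs y ys py)
  ... | false = refl

  dropKeysWhile-++-stop : ∀ xs y ys → p (proj₁ y) ≡ false →
    dropKeysWhile p (xs ++ y ∷ ys) ≡ dropKeysWhile p xs ++ y ∷ ys
  dropKeysWhile-++-stop [] y ys py rewrite py = refl
  dropKeysWhile-++-stop (x ∷ xs) y ys py with p (proj₁ x)
  ... | true = dropKeysWhile-++-stop xs y ys py
  ... | false = refl

  takeKeysWhile-++-all : ∀ xs ys → AllKeys p xs → takeKeysWhile p (xs ++ ys) ≡ xs ++ takeKeysWhile p ys
  takeKeysWhile-++-all [] ys [] = refl
  takeKeysWhile-++-all (x ∷ xs) ys (px ∷ pxs) rewrite px = cong (x ∷_) (takeKeysWhile-++-all xs ys pxs)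

  takeKeysWhile-all : ∀ xs → AllKeys p xs → takeKeysWhile p xs ≡ xs
  takeKeysWhile-all xs pxs = trans (cong (takeKeysWhile p) (sym (List.++-identityʳ xs)))
    (trans (takeKeysWhile-++-all xs [] pxs) (List.++-identityʳ xs))

  dropKeysWhile-none : ∀ ys → All (λ e → p (proj₁ e) ≡ false) ys → dropKeysWhile p ys ≡ ys
  dropKeysWhile-none [] _ = refl
  dropKeysWhile-none (y ∷ ys) (py ∷ _) rewrite py = refl

  dropKeysWhile-++-all : ∀ xs ys → AllKeys p xs → dropKeysWhile p (xs ++ ys) ≡ dropKeysWhile p ys
  dropKeysWhile-++-all [] ys [] = refl
  dropKeysWhile-++-all (x ∷ xs) ys (px ∷ pxs) rewrite px = dropKeysWhile-++-all xs ys pxs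

All-reverse : ∀ {P : ℕ → Set} {xs} → All P xs → All P (reverse xs)
All-reverse {xs = []} [] = []
All-reverse {xs = x ∷ xs} (px ∷ pxs) rewrite List.unfold-reverse x xs = All.++⁺ (All-reverse pxs) (px ∷ [])

reverse-++-∷ : ∀ (xs : List ℕ) r ys → reverse (xs ++ r ∷ ys) ≡ reverse ys ++ r ∷ reverse xs
reverse-++-∷ xs r ys = begin
  reverse (xs ++ r ∷ ys)              ≡⟨ List.reverse-++ xs (r ∷ ys) ⟩
  reverse (r ∷ ys) ++ reverse xs      ≡⟨ cong (_++ reverse xs) (List.unfold-reverse r ys) ⟩
  (reverse ys ++ r ∷ []) ++ reverse xs ≡⟨ List.++-assoc (reverse ys) (r ∷ []) (reverse xs) ⟩
  reverse ys ++ r ∷ reverse xs        ∎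
  where open ≡-Reasoning

-- If p and q hold exactly for the keys before, respectively not after, the searched key a, then pathBound
-- counts the weak records below ρ among the ranks before a, read from a outwards, and the strict records
-- up to ρ among the ranks after a.  The unzipped path and the zipped spines consist of such records.
pathBound : ℕ → (ℕ → Bool) → (ℕ → Bool) → List (ℕ × ℕ) → ℕ
pathBound ρ p q es =
  weakRecordsBelow ρ 0 (reverse (ranks (takeKeysWhile p es)))
  +ℕ strictRecordsBelow (suc ρ) 0 (ranks (dropKeysWhile q es))

ranks≤ : ∀ {q} T → ZipHeap T → RightRankOk q T → All (λ e → proj₂ e ≤ℕ q) (inorder T)
ranks≤ leaf _ _ = []
ranks≤ {q} (node l k r t) (hl , ht , lo , ro) r≤q =
  All.++⁺ (ranks≤ l hl (left l lo)) (r≤q ∷ ranks≤ t ht (right t ro))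
  where
  left : ∀ l → LeftRankOk r l → RightRankOk q l
  left leaf _ = tt
  left (node _ _ _ _) r′<r = ℕ.<⇒≤ (ℕ.<-≤-trans r′<r r≤q)
  right : ∀ t → RightRankOk r t → RightRankOk q t
  right leaf _ = tt
  right (node _ _ _ _) r′≤r = ℕ.≤-trans r′≤r r≤q

ranks< : ∀ {q} T → ZipHeap T → LeftRankOk q T → All (λ e → proj₂ e <ℕ q) (inorder T)
ranks< leaf _ _ = []
ranks< T@(node _ _ _ _) hT r<q = All.map (λ x≤r → ℕ.≤-<-trans x≤r r<q) (ranks≤ T hT ℕ.≤-refl)

pathBound-node-left : ∀ ρ p q l k r t → ZipHeap l → LeftRankOk r l → p k ≡ false → q k ≡ false →
  pathBound ρ p q (inorder l) +ℕ 𝟙 (r <? suc ρ) ≤ℕ pathBound ρ p q (inorder (node l k r t))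
pathBound-node-left ρ p q l k r t hl lo pk qk
  rewrite takeKeysWhile-++-stop p (inorder l) (k , r) (inorder t) pk
        | dropKeysWhile-++-stop q (inorder l) (k , r) (inorder t) qk
        | List.map-++ proj₂ (dropKeysWhile q (inorder l)) ((k , r) ∷ inorder t) =
  ℕ.≤-trans (ℕ.≤-reflexive (ℕ.+-assoc W _ (𝟙 (r <? suc ρ))))
    (ℕ.+-monoʳ-≤ W (recordsBelow-++-record suc (suc ρ) (ranks (dropKeysWhile q (inorder l))) (ranks (inorder t))
      (All.map⁺ (All.dropWhile⁺ _ (ranks< l hl lo))) z≤n))
  where W = weakRecordsBelow ρ 0 (reverse (ranks (takeKeysWhile p (inorder l))))

pathBound-node-right : ∀ ρ p q l k r t → ZipHeap t → RightRankOk r t → p k ≡ true → q k ≡ true →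
  AllKeys p (inorder l) → AllKeys q (inorder l) →
  pathBound ρ p q (inorder t) +ℕ 𝟙 (r <? ρ) ≤ℕ pathBound ρ p q (inorder (node l k r t))
pathBound-node-right ρ p q l k r t ht ro pk qk pl ql
  rewrite takeKeysWhile-++-all p (inorder l) ((k , r) ∷ inorder t) pl
        | dropKeysWhile-++-all q (inorder l) ((k , r) ∷ inorder t) ql | pk | qk
        | List.map-++ proj₂ (inorder l) ((k , r) ∷ takeKeysWhile p (inorder t))
        | reverse-++-∷ (ranks (inorder l)) r (ranks (takeKeysWhile p (inorder t))) =
  ℕ.≤-trans (ℕ.≤-reflexive (xy∙z≈xz∙y W S (𝟙 (r <? ρ))))
    (ℕ.+-monoˡ-≤ S (recordsBelow-++-record (λ x → x) ρ
      (reverse (ranks (takeKeysWhile p (inorder t)))) (reverse (ranks (inorder l)))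
      (All-reverse (All.map⁺ (All.takeWhile⁺ _ (ranks≤ t ht ro)))) z≤n))
  where
  W = weakRecordsBelow ρ 0 (reverse (ranks (takeKeysWhile p (inorder t))))
  S = strictRecordsBelow (suc ρ) 0 (ranks (dropKeysWhile q (inorder t)))

Sorted : List (ℕ × ℕ) → Set
Sorted = AllPairs (λ e e′ → proj₁ e <ℕ proj₁ e′)

Sorted-++-∷ : ∀ xs y ys → Sorted (xs ++ y ∷ ys) →
  Sorted xs × Sorted ys × All (λ x → proj₁ x <ℕ proj₁ y) xs × All (λ z → proj₁ y <ℕ proj₁ z) ys
Sorted-++-∷ [] y ys (y<ys ∷ sys) = [] , sys , [] , y<ys
Sorted-++-∷ (x ∷ xs) y ys (x<rest ∷ srest) with Sorted-++-∷ xs y ys srest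
... | sxs , sys , xs<y , y<ys with All.++⁻ xs x<rest
...   | x<xs , x<y ∷ _ = (x<xs ∷ sxs) , sys , (x<y ∷ xs<y) , y<ys

<ᵇ-true : ∀ {m n} → (m <ᵇ n) ≡ true → m <ℕ n
<ᵇ-true {m} {n} m<ᵇn = ℕ.<ᵇ⇒< m n (subst T (sym m<ᵇn) tt)

≡ᵇ-true : ∀ {m n} → (m ≡ᵇ n) ≡ true → m ≡ n
≡ᵇ-true {m} {n} m≡ᵇn = ℕ.≡ᵇ⇒≡ m n (subst T (sym m≡ᵇn) tt)

<ᵇ-false : ∀ {m n} → (m <ᵇ n) ≡ false → ¬ m <ℕ n
<ᵇ-false m≮ᵇn m<n = subst T m≮ᵇn (ℕ.<⇒<ᵇ m<n)

<⇒<ᵇ-true : ∀ {m n} → m <ℕ n → (m <ᵇ n) ≡ true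
<⇒<ᵇ-true {m} {n} m<n with m <ᵇ n in m<ᵇn
... | true = refl
... | false = ⊥-elim (<ᵇ-false m<ᵇn m<n)

≮⇒<ᵇ-false : ∀ {m n} → ¬ m <ℕ n → (m <ᵇ n) ≡ false
≮⇒<ᵇ-false {m} {n} m≮n with m <ᵇ n in m<ᵇn
... | true = ⊥-elim (m≮n (<ᵇ-true m<ᵇn))
... | false = refl

<ᵇ-asym : ∀ {m n} → (m <ᵇ n) ≡ true → (n <ᵇ m) ≡ false
<ᵇ-asym {m} {n} m<ᵇn = ≮⇒<ᵇ-false {n} {m} (ℕ.<⇒≯ (<ᵇ-true {m} m<ᵇn))

<ᵇ-false∧≢⇒> : ∀ {m n} → (m <ᵇ n) ≡ false → m ≢ n → n <ℕ m
<ᵇ-false∧≢⇒> {m} m≮ᵇn m≢n = ℕ.≤∧≢⇒< (ℕ.≮⇒≥ (<ᵇ-false {m} m≮ᵇn)) (λ n≡m → m≢n (sym n≡m))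

n≮ᵇn : ∀ n → (n <ᵇ n) ≡ false
n≮ᵇn n = ≮⇒<ᵇ-false {n} (ℕ.<-irrefl refl)

≤⇒suc≤+𝟙 : ∀ {v w} {P : Set} (P? : Dec P) → P → v ≤ℕ w → suc v ≤ℕ w +ℕ 𝟙 P?
≤⇒suc≤+𝟙 P? p v≤w rewrite 𝟙-yes P? p = ℕ.≤-trans (s≤s v≤w) (ℕ.≤-reflexive (ℕ.+-comm 1 _))

-- Insertion

atMost : ℕ → ℕ → Bool
atMost a k = not (a <ᵇ k)

module Insertion (a ρ : ℕ) where

  P : List (ℕ × ℕ) → ℕ
  P = pathBound ρ (atMost a) (atMost a)

  goLeft : ∀ l k r t {v} → ZipHeap l → LeftRankOk r l → (a <ᵇ k) ≡ true →
    v ≤ℕ P (inorder l) +ℕ 𝟙 (r <? suc ρ) → v ≤ℕ P (inorder (node l k r t))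
  goLeft l k r t hl lo a<k v≤ = ℕ.≤-trans v≤
    (pathBound-node-left ρ (atMost a) (atMost a) l k r t hl lo (cong not a<k) (cong not a<k))

  goRight : ∀ l k r t {v} → ZipHeap t → RightRankOk r t → (a <ᵇ k) ≡ false → All (λ x → proj₁ x <ℕ k) (inorder l) →
    v ≤ℕ P (inorder t) +ℕ 𝟙 (r <? ρ) → v ≤ℕ P (inorder (node l k r t))
  goRight l k r t ht ro a≮k l<k v≤ = ℕ.≤-trans v≤
    (pathBound-node-right ρ (atMost a) (atMost a) l k r t ht ro (cong not a≮k) (cong not a≮k) l≤a l≤a)
    where
    l≤a : AllKeys (atMost a) (inorder l)
    l≤a = All.map (λ x<k → cong not (≮⇒<ᵇ-false (λ a<x → <ᵇ-false {a} a≮k (ℕ.<-trans a<x x<k)))) l<k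

  searchLen≤pathBound : ∀ T → ZipHeap T → Sorted (inorder T) → All (λ e → proj₂ e <ℕ ρ) (inorder T) →
    searchLen a T ≤ℕ P (inorder T)

  searchLeft : ∀ l k r t → ZipHeap l → LeftRankOk r l → Sorted (inorder l) → (a <ᵇ k) ≡ true → r ≤ℕ ρ →
    suc (searchLen a l) ≤ℕ P (inorder (node l k r t))
  searchLeft l k r t hl lo sl a<k r≤ρ = goLeft l k r t hl lo a<k (≤⇒suc≤+𝟙 (r <? suc ρ) (s≤s r≤ρ)
    (searchLen≤pathBound l hl sl (All.map (λ x<r → ℕ.<-≤-trans x<r r≤ρ) (ranks< l hl lo))))

  searchRight : ∀ l k r t → ZipHeap t → RightRankOk r t → Sorted (inorder t) → (a <ᵇ k) ≡ false →
    All (λ x → proj₁ x <ℕ k) (inorder l) → r <ℕ ρ → suc (searchLen a t) ≤ℕ P (inorder (node l k r t))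
  searchRight l k r t ht ro st a≮k l<k r<ρ = goRight l k r t ht ro a≮k l<k (≤⇒suc≤+𝟙 (r <? ρ) r<ρ
    (searchLen≤pathBound t ht st (All.map (λ x≤r → ℕ.≤-<-trans x≤r r<ρ) (ranks≤ t ht ro))))

  searchLen≤pathBound leaf _ _ _ = z≤n
  searchLen≤pathBound (node l k r t) (hl , ht , lo , ro) s <ρ
    with Sorted-++-∷ (inorder l) (k , r) (inorder t) s | All.++⁻ (inorder l) <ρ
  ... | sl , st , l<k , _ | _ , r<ρ ∷ _ with a <ᵇ k in a<k
  ...   | true = searchLeft l k r t hl lo sl a<k (ℕ.<⇒≤ r<ρ)
  ...   | false = searchRight l k r t ht ro st a<k l<k r<ρ

  unzipLen≤pathBound : ∀ T → ZipHeap T → Sorted (inorder T) → unzipLen a ρ T ≤ℕ P (inorder T)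
  unzipLen≤pathBound leaf _ _ = z≤n
  unzipLen≤pathBound (node l k r t) (hl , ht , lo , ro) s with Sorted-++-∷ (inorder l) (k , r) (inorder t) s
  ... | sl , st , l<k , _ with a <ᵇ k in a<k | k <ᵇ a in k<a | r <ᵇ ρ in r<ρ | r ≡ᵇ ρ in r≡ρ
  ...   | true | true | _ | _ = ⊥-elim (ℕ.<-asym (<ᵇ-true {a} a<k) (<ᵇ-true {k} k<a))
  ...   | true | false | true | _ = searchLeft l k r t hl lo sl a<k (ℕ.<⇒≤ (<ᵇ-true {r} r<ρ))
  ...   | true | false | false | true = searchLeft l k r t hl lo sl a<k (ℕ.≤-reflexive (≡ᵇ-true {r} r≡ρ))
  ...   | true | false | false | false = goLeft l k r t hl lo a<k (ℕ.m≤n⇒m≤n+o _ (unzipLen≤pathBound l hl sl))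
  ...   | false | true | true | _ = searchRight l k r t ht ro st a<k l<k (<ᵇ-true {r} r<ρ)
  ...   | false | true | false | _ = goRight l k r t ht ro a<k l<k (ℕ.m≤n⇒m≤n+o _ (unzipLen≤pathBound t ht st))
  ...   | false | false | _ | _ = goRight l k r t ht ro a<k l<k (ℕ.m≤n⇒m≤n+o _ (unzipLen≤pathBound t ht st))

-- Deletion

rightSpineLen≤ : ∀ ρ l → ZipHeap l → All (λ e → proj₂ e <ℕ ρ) (inorder l) →
  rightSpineLen l ≤ℕ weakRecordsBelow ρ 0 (reverse (ranks (inorder l)))
rightSpineLen≤ ρ leaf _ _ = z≤n
rightSpineLen≤ ρ (node l k r t) (hl , ht , lo , ro) <ρ with All.++⁻ (inorder l) <ρ
... | _ , r<ρ ∷ t<ρ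
  rewrite List.map-++ proj₂ (inorder l) ((k , r) ∷ inorder t) | reverse-++-∷ (ranks (inorder l)) r (ranks (inorder t)) =
  ℕ.≤-trans (≤⇒suc≤+𝟙 (r <? ρ) r<ρ (rightSpineLen≤ ρ t ht t<ρ))
    (recordsBelow-++-record (λ x → x) ρ (reverse (ranks (inorder t))) (reverse (ranks (inorder l)))
      (All-reverse (All.map⁺ (ranks≤ t ht ro))) z≤n)

leftSpineLen≤ : ∀ ρ t → ZipHeap t → All (λ e → proj₂ e ≤ℕ ρ) (inorder t) →
  leftSpineLen t ≤ℕ strictRecordsBelow (suc ρ) 0 (ranks (inorder t))
leftSpineLen≤ ρ leaf _ _ = z≤n
leftSpineLen≤ ρ (node l k r t) (hl , ht , lo , ro) ≤ρ with All.++⁻ (inorder l) ≤ρ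
... | l≤ρ , r≤ρ ∷ _ rewrite List.map-++ proj₂ (inorder l) ((k , r) ∷ inorder t) =
  ℕ.≤-trans (≤⇒suc≤+𝟙 (r <? suc ρ) (s≤s r≤ρ) (leftSpineLen≤ ρ l hl l≤ρ))
    (recordsBelow-++-record suc (suc ρ) (ranks (inorder l)) (ranks (inorder t)) (All.map⁺ (ranks< l hl lo)) z≤n)

below : ℕ → ℕ → Bool
below a k = k <ᵇ a

module _ {a ρ k r : ℕ} {xs ys : List (ℕ × ℕ)} (xs<k : All (λ x → proj₁ x <ℕ k) xs) (k<ys : All (λ y → k <ℕ proj₁ y) ys)
         (a∈ : (a , ρ) ∈ xs ++ (k , r) ∷ ys) where

  ∈-left : a <ℕ k → (a , ρ) ∈ xs
  ∈-left a<k with ∈-++⁻ xs a∈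
  ... | inj₁ a∈xs = a∈xs
  ... | inj₂ (here refl) = ⊥-elim (ℕ.<-irrefl refl a<k)
  ... | inj₂ (there a∈ys) = ⊥-elim (ℕ.<-asym a<k (All.lookup k<ys a∈ys))

  ∈-right : k <ℕ a → (a , ρ) ∈ ys
  ∈-right k<a with ∈-++⁻ xs a∈
  ... | inj₁ a∈xs = ⊥-elim (ℕ.<-asym k<a (All.lookup xs<k a∈xs))
  ... | inj₂ (here refl) = ⊥-elim (ℕ.<-irrefl refl k<a)
  ... | inj₂ (there a∈ys) = a∈ys

  ∈-root : a ≡ k → ρ ≡ r
  ∈-root refl with ∈-++⁻ xs a∈
  ... | inj₁ a∈xs = ⊥-elim (ℕ.<-irrefl refl (All.lookup xs<k a∈xs))
  ... | inj₂ (here refl) = refl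
  ... | inj₂ (there a∈ys) = ⊥-elim (ℕ.<-irrefl refl (All.lookup k<ys a∈ys))

module Deletion (a ρ : ℕ) where

  P : List (ℕ × ℕ) → ℕ
  P = pathBound ρ (below a) (atMost a)

  zipLen≤pathBound : ∀ T → ZipHeap T → Sorted (inorder T) → (a , ρ) ∈ inorder T → zipLen a T ≤ℕ P (inorder T)
  zipLen≤pathBound leaf _ _ ()
  zipLen≤pathBound (node l k r t) (hl , ht , lo , ro) s a∈ with Sorted-++-∷ (inorder l) (k , r) (inorder t) s
  ... | sl , st , l<k , k<t with a ≡ᵇ k in a≡k
  ...   | true = atRoot (≡ᵇ-true {a} a≡k)
    where
    atRoot : a ≡ k → rightSpineLen l +ℕ leftSpineLen t ≤ℕ P (inorder (node l k r t))
    atRoot refl rewrite sym (∈-root l<k k<t a∈ refl)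
      | takeKeysWhile-++-stop (below a) (inorder l) (a , ρ) (inorder t) (n≮ᵇn a)
      | takeKeysWhile-all (below a) (inorder l) (All.map <⇒<ᵇ-true l<k)
      | dropKeysWhile-++-all (atMost a) (inorder l) ((a , ρ) ∷ inorder t) (All.map (cong not ∘ ≮⇒<ᵇ-false ∘ ℕ.<⇒≯) l<k)
      | n≮ᵇn a
      | dropKeysWhile-none (atMost a) (inorder t) (All.map (cong not ∘ <⇒<ᵇ-true) k<t) =
      ℕ.+-mono-≤ (rightSpineLen≤ ρ l hl (ranks< l hl lo)) (leftSpineLen≤ ρ t ht (ranks≤ t ht ro))
  ...   | false with a <ᵇ k in a<k
  ...     | true = ℕ.≤-trans (ℕ.m≤n⇒m≤n+o _ (zipLen≤pathBound l hl sl (∈-left l<k k<t a∈ (<ᵇ-true {a} a<k))))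
    (pathBound-node-left ρ (below a) (atMost a) l k r t hl lo (<ᵇ-asym {a} a<k) (cong not a<k))
  ...     | false = ℕ.≤-trans (ℕ.m≤n⇒m≤n+o _ (zipLen≤pathBound t ht st (∈-right l<k k<t a∈ k<a)))
    (pathBound-node-right ρ (below a) (atMost a) l k r t ht ro (<⇒<ᵇ-true k<a) (cong not a<k)
      (All.map (λ x<k → <⇒<ᵇ-true (ℕ.<-trans x<k k<a)) l<k)
      (All.map (λ x<k → cong not (≮⇒<ᵇ-false (ℕ.<⇒≯ (ℕ.<-trans x<k k<a)))) l<k))
    where
    k<a : k <ℕ a
    k<a = <ᵇ-false∧≢⇒> {a} a<k (λ a≡k′ → subst T a≡k (ℕ.≡⇒≡ᵇ a k a≡k′))

ranks-zip : ∀ (ks rs : List ℕ) → length rs ≡ length ks → ranks (zip ks rs) ≡ rs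
ranks-zip [] [] _ = refl
ranks-zip (k ∷ ks) (r ∷ rs) ∣rs∣≡∣ks∣ = cong (r ∷_) (ranks-zip ks rs (ℕ.suc-injective ∣rs∣≡∣ks∣))

module _ (p : ℕ → Bool) where

  ranks-takeKeysWhile-zip : ∀ (ks rs : List ℕ) → length rs ≡ length ks →
    ranks (takeKeysWhile p (zip ks rs)) ≡ take (length (takeWhileᵇ p ks)) rs
  ranks-takeKeysWhile-zip [] [] _ = refl
  ranks-takeKeysWhile-zip (k ∷ ks) (r ∷ rs) ∣rs∣≡∣ks∣ with p k
  ... | true = cong (r ∷_) (ranks-takeKeysWhile-zip ks rs (ℕ.suc-injective ∣rs∣≡∣ks∣))
  ... | false = refl

  ranks-dropKeysWhile-zip : ∀ (ks rs : List ℕ) → length rs ≡ length ks →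
    ranks (dropKeysWhile p (zip ks rs)) ≡ drop (length (takeWhileᵇ p ks)) rs
  ranks-dropKeysWhile-zip [] [] _ = refl
  ranks-dropKeysWhile-zip (k ∷ ks) (r ∷ rs) ∣rs∣≡∣ks∣ with p k
  ... | true = ranks-dropKeysWhile-zip ks rs (ℕ.suc-injective ∣rs∣≡∣ks∣)
  ... | false = cong (r ∷_) (ranks-zip ks rs (ℕ.suc-injective ∣rs∣≡∣ks∣))

  length-takeWhileᵇ≤ : ∀ (ks : List ℕ) → length (takeWhileᵇ p ks) ≤ℕ length ks
  length-takeWhileᵇ≤ [] = z≤n
  length-takeWhileᵇ≤ (k ∷ ks) with p k
  ... | true = s≤s (length-takeWhileᵇ≤ ks)
  ... | false = z≤n

pathBound-zip : ∀ ρ p q (ks rs : List ℕ) → length rs ≡ length ks →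
  length (takeWhileᵇ p ks) ≡ length (takeWhileᵇ q ks) →
  pathBound ρ p q (zip ks rs) ≡ rankBound ρ (length (takeWhileᵇ q ks)) rs
pathBound-zip ρ p q ks rs ∣rs∣≡∣ks∣ ∣p∣≡∣q∣ = cong₂ _+ℕ_
  (cong (λ xs → weakRecordsBelow ρ 0 (reverse xs))
    (trans (ranks-takeKeysWhile-zip p ks rs ∣rs∣≡∣ks∣) (cong (λ m → take m rs) ∣p∣≡∣q∣)))
  (cong (strictRecordsBelow (suc ρ) 0) (ranks-dropKeysWhile-zip q ks rs ∣rs∣≡∣ks∣))

All-zip : ∀ {P : ℕ → Set} (ks rs : List ℕ) → All P ks → All (λ e → P (proj₁ e)) (zip ks rs)
All-zip [] rs _ = []
All-zip (k ∷ ks) [] _ = []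
All-zip (k ∷ ks) (r ∷ rs) (pk ∷ pks) = pk ∷ All-zip ks rs pks

Sorted-zip : ∀ (ks rs : List ℕ) → AllPairs _<ℕ_ ks → Sorted (zip ks rs)
Sorted-zip [] rs _ = []
Sorted-zip (k ∷ ks) [] _ = []
Sorted-zip (k ∷ ks) (r ∷ rs) (k<ks ∷ ks↑) = All-zip ks rs k<ks ∷ Sorted-zip ks rs ks↑

module _ (a ρ : ℕ) where

  All-insertByKey : ∀ {P : ℕ × ℕ → Set} es → P (a , ρ) → All P es → All P (insertByKey (a , ρ) es)
  All-insertByKey [] pa [] = pa ∷ []
  All-insertByKey ((k , r) ∷ es) pa (pe ∷ pes) with a <ᵇ k
  ... | true = pa ∷ pe ∷ pes
  ... | false = pe ∷ All-insertByKey es pa pes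

  Sorted-insertByKey : ∀ es → Sorted es → All (λ e → a ≢ proj₁ e) es → Sorted (insertByKey (a , ρ) es)
  Sorted-insertByKey [] _ _ = [] ∷ []
  Sorted-insertByKey ((k , r) ∷ es) (k<es ∷ es↑) (a≢k ∷ a≢es) with a <ᵇ k in a<k
  ... | true = (<ᵇ-true {a} a<k ∷ All.map (ℕ.<-trans (<ᵇ-true {a} a<k)) k<es) ∷ k<es ∷ es↑
  ... | false = All-insertByKey es (<ᵇ-false∧≢⇒> {a} a<k a≢k) k<es ∷ Sorted-insertByKey es es↑ a≢es

  ∈-insertByKey : ∀ es → (a , ρ) ∈ insertByKey (a , ρ) es
  ∈-insertByKey [] = here refl
  ∈-insertByKey ((k , r) ∷ es) with a <ᵇ k
  ... | true = here refl
  ... | false = there (∈-insertByKey es)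

  takeKeysWhile-below-insertByKey : ∀ es → All (λ e → a ≢ proj₁ e) es →
    takeKeysWhile (below a) (insertByKey (a , ρ) es) ≡ takeKeysWhile (below a) es
  takeKeysWhile-below-insertByKey [] _ rewrite n≮ᵇn a = refl
  takeKeysWhile-below-insertByKey ((k , r) ∷ es) (a≢k ∷ a≢es) with a <ᵇ k in a<k
  ... | true rewrite n≮ᵇn a | <ᵇ-asym {a} {k} a<k = refl
  ... | false rewrite <⇒<ᵇ-true (<ᵇ-false∧≢⇒> {a} a<k a≢k) =
    cong ((k , r) ∷_) (takeKeysWhile-below-insertByKey es a≢es)

  dropKeysWhile-atMost-insertByKey : ∀ es →
    dropKeysWhile (atMost a) (insertByKey (a , ρ) es) ≡ dropKeysWhile (atMost a) es
  dropKeysWhile-atMost-insertByKey [] rewrite n≮ᵇn a = refl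
  dropKeysWhile-atMost-insertByKey ((k , r) ∷ es) with a <ᵇ k in a<k
  ... | true rewrite n≮ᵇn a | a<k = refl
  ... | false rewrite a<k = dropKeysWhile-atMost-insertByKey es

  length-takeWhile-below≡atMost : ∀ ks → All (a ≢_) ks →
    length (takeWhileᵇ (below a) ks) ≡ length (takeWhileᵇ (atMost a) ks)
  length-takeWhile-below≡atMost [] _ = refl
  length-takeWhile-below≡atMost (k ∷ ks) (a≢k ∷ a≢ks) with a <ᵇ k in a<k
  ... | true rewrite <ᵇ-asym {a} {k} a<k = refl
  ... | false rewrite <⇒<ᵇ-true (<ᵇ-false∧≢⇒> {a} a<k a≢k) =
    cong suc (length-takeWhile-below≡atMost ks a≢ks)

insertionIndex : ℕ → List ℕ → ℕ
insertionIndex a ks = length (takeWhileᵇ (atMost a) ks)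

unzipLen≤rankBound : ∀ a ρ ks (T : List ℕ → Tree) → Linked _<ℕ_ ks → ZipFamilyIns ks T →
  ∀ rs → length rs ≡ length ks → unzipLen a ρ (T rs) ≤ℕ rankBound ρ (insertionIndex a ks) rs
unzipLen≤rankBound a ρ ks T ks↑ famT rs ∣rs∣≡∣ks∣ with famT rs ∣rs∣≡∣ks∣
... | hT , T≡ = subst (unzipLen a ρ (T rs) ≤ℕ_)
  (trans (cong (pathBound ρ (atMost a) (atMost a)) T≡) (pathBound-zip ρ (atMost a) (atMost a) ks rs ∣rs∣≡∣ks∣ refl))
  (Insertion.unzipLen≤pathBound a ρ (T rs) hT (subst Sorted (sym T≡) (Sorted-zip ks rs (Linked⇒AllPairs ℕ.<-trans ks↑))))

zipLen≤rankBound : ∀ a ρ ks (T : List ℕ → Tree) → Linked _<ℕ_ ks → a ∉ ks → ZipFamilyDel a ρ ks T →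
  ∀ rs → length rs ≡ length ks → zipLen a (T rs) ≤ℕ rankBound ρ (insertionIndex a ks) rs
zipLen≤rankBound a ρ ks T ks↑ a∉ks famT rs ∣rs∣≡∣ks∣ with famT rs ∣rs∣≡∣ks∣
... | hT , T≡ = subst (zipLen a (T rs) ≤ℕ_)
  (begin
    pathBound ρ (below a) (atMost a) (inorder (T rs))
      ≡⟨ cong (pathBound ρ (below a) (atMost a)) T≡ ⟩
    pathBound ρ (below a) (atMost a) (insertByKey (a , ρ) (zip ks rs))
      ≡⟨ cong₂ (λ xs ys → weakRecordsBelow ρ 0 (reverse (ranks xs)) +ℕ strictRecordsBelow (suc ρ) 0 (ranks ys))
           (takeKeysWhile-below-insertByKey a ρ (zip ks rs) a≢zip) (dropKeysWhile-atMost-insertByKey a ρ (zip ks rs)) ⟩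
    pathBound ρ (below a) (atMost a) (zip ks rs)
      ≡⟨ pathBound-zip ρ (below a) (atMost a) ks rs ∣rs∣≡∣ks∣ (length-takeWhile-below≡atMost a ρ ks a≢ks) ⟩
    rankBound ρ (insertionIndex a ks) rs ∎)
  (Deletion.zipLen≤pathBound a ρ (T rs) hT
    (subst Sorted (sym T≡) (Sorted-insertByKey a ρ (zip ks rs) (Sorted-zip ks rs (Linked⇒AllPairs ℕ.<-trans ks↑)) a≢zip))
    (subst ((a , ρ) ∈_) (sym T≡) (∈-insertByKey a ρ (zip ks rs))))
  where
  open ≡-Reasoning
  a≢ks : All (a ≢_) ks
  a≢ks = All.¬Any⇒All¬ ks a∉ks
  a≢zip : All (λ e → a ≢ proj₁ e) (zip ks rs)
  a≢zip = All-zip ks rs a≢ks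

theorem4 :
    ((k ρ a : ℕ) (ks : List ℕ) → ρ ≤ℕ k → Linked _<ℕ_ ks → a ∉ ks →
      (T : List ℕ → Tree) → ZipFamilyIns ks T →
      (B : ℕ) → truncExp (length ks) B (λ rs → unzipLen a ρ (T rs)) ≤ bound k)
    × ((k ρ a : ℕ) (ks : List ℕ) → ρ ≤ℕ k → Linked _<ℕ_ ks → a ∉ ks →
      (T : List ℕ → Tree) → ZipFamilyDel a ρ ks T →
      (B : ℕ) → truncExp (length ks) B (λ rs → zipLen a (T rs)) ≤ bound k)
    × Σ ℚ (λ c → 1ℚ < c × Σ ℕ (λ C →
        ((k ρ a : ℕ) (ks : List ℕ) → ρ ≤ℕ k → Linked _<ℕ_ ks → a ∉ ks →
          (T : List ℕ → Tree) → ZipFamilyIns ks T → (B : ℕ) →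
          truncProb (length ks) B (λ rs → (C *ℕ (k +ℕ 1)) <ᵇ unzipLen a ρ (T rs))
            * (twoℚ * powℚ c k) ≤ 1ℚ)
        × ((k ρ a : ℕ) (ks : List ℕ) → ρ ≤ℕ k → Linked _<ℕ_ ks → a ∉ ks →
          (T : List ℕ → Tree) → ZipFamilyDel a ρ ks T → (B : ℕ) →
          truncProb (length ks) B (λ rs → (C *ℕ (k +ℕ 1)) <ᵇ zipLen a (T rs))
            * (twoℚ * powℚ c k) ≤ 1ℚ)))
theorem4 =
  (λ k ρ a ks ρ≤k ks↑ _ T famT B →
    𝔼≤bound B _ ρ≤k (insertionIndex≤ a ks) (unzipLen≤rankBound a ρ ks T ks↑ famT)) ,
  (λ k ρ a ks ρ≤k ks↑ a∉ks T famT B →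
    𝔼≤bound B _ ρ≤k (insertionIndex≤ a ks) (zipLen≤rankBound a ρ ks T ks↑ a∉ks famT)) ,
  twoℚ , toWitness {a? = 1ℚ ℚ.<? twoℚ} tt , 5 ,
  (λ k ρ a ks ρ≤k ks↑ _ T famT B →
    tail≤ B _ ρ≤k (insertionIndex≤ a ks) (unzipLen≤rankBound a ρ ks T ks↑ famT)) ,
  (λ k ρ a ks ρ≤k ks↑ a∉ks T famT B →
    tail≤ B _ ρ≤k (insertionIndex≤ a ks) (zipLen≤rankBound a ρ ks T ks↑ a∉ks famT))
  where
  insertionIndex≤ : ∀ a ks → insertionIndex a ks ≤ℕ length ks
  insertionIndex≤ a = length-takeWhileᵇ≤ (atMost a)
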